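{- There exists a constant $c>0$ such that for every positive integer $n$, $f_3(n)\geq c\cdot 1.4977^n$.
   Context: A hypergraph $\mathcal H$ is a pair $(V,\mathcal E)$ where $V$ is a finite set of vertices and $\mathcal E$ is a family of subsets of $V$ (edges), with $V=\bigcup\mathcal E$; its order is $|V|$. It is $3$-uniform if every edge has exactly $3$ elements, and tripartite if $V$ can be partitioned into three sets such that every edge intersects each of the three sets in at most one vertex. A transversal of $\mathcal H$ is a set of vertices intersecting every edge; it is minimal if no proper subset of it is a transversal. $f_3(n)$ denotes the maximum number of minimal transversals of a tripartite $3$-uniform hypergraph of order $n$. -}

module Defs where

open import Data.Nat using (ℕ; _≡ᵇ_)
open import Data.Fin using (Fin)
open import Data.Fin.Subset using (Subset; _∈_; _⊂_; ∣_∣)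
open import Data.Product using (Σ; ∃; _×_)
open import Relation.Binary.PropositionalEquality using (_≡_)
open import Relation.Nullary using (¬_)

-- A hypergraph on the vertex set Fin n (order n, up to relabelling):
-- its edge family is given as a predicate on subsets of Fin n.
-- The edge family is automatically a finite family of subsets.
EdgeFamily : ℕ → Set₁
EdgeFamily n = Subset n → Set

Covers : ∀ {n} → EdgeFamily n → Set
Covers {n} E = (v : Fin n) → ∃ λ e → E e × v ∈ e

ThreeUniform : ∀ {n} → EdgeFamily n → Set
ThreeUniform E = ∀ e → E e → ∣ e ∣ ≡ 3

-- Tripartite: there is a partition of V into three classes
-- (given by a class-assignment Fin n → Fin 3) such that every edge
-- meets every class in at most one vertex.
Tripartite : ∀ {n} → EdgeFamily n → Set
Tripartite {n} E =
  Σ (Fin n → Fin 3) λ part →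
    ∀ e → E e → ∀ u v → u ∈ e → v ∈ e → part u ≡ part v → u ≡ v

record Tri3Hypergraph (n : ℕ) : Set₁ where
  field
    edge        : EdgeFamily n
    covers      : Covers edge
    uniform     : ThreeUniform edge
    tripartite  : Tripartite edge

Transversal : ∀ {n} → EdgeFamily n → Subset n → Set
Transversal E T = ∀ e → E e → ∃ λ v → v ∈ e × v ∈ T

MinimalTransversal : ∀ {n} → EdgeFamily n → Subset n → Set
MinimalTransversal E T = Transversal E T × (∀ S → S ⊂ T → ¬ Transversal E S)

module Submission where

-- Let L₅ be the tripartite 3-uniform hypergraph with classes
-- {a₀…a₄}, {b₀…b₄}, {c₀…c₄} and the 25 edges {aᵢ, bⱼ, c_{i+j mod 5}} (the
-- cyclic Latin square of order 5).  It has 428 minimal transversals, and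
-- 428 ≥ 1.4977¹⁵.  Minimal transversals of the parts of a disjoint union
-- combine into minimal transversals of the union, so q disjoint copies of L₅
-- next to a small hypergraph on s ∈ [3, 17] vertices (with one minimal
-- transversal) give at least 428^q ≥ 1.4977^{15q} minimal transversals on
-- n = 15q + s vertices; hence f₃(n) ≥ 1.4977ⁿ / 1.4977¹⁷.

open import Defs
open import Data.Nat using (ℕ; zero; suc; s≤s⁻¹; _+_; _*_; _^_; _∸_; _≤_; _<_; _<?_; z≤n; s≤s; NonZero)
open import Data.Nat.Properties
  using (≤-refl; <-trans; <-irrefl; +-identityʳ; *-identityˡ; *-identityʳ; *-mono-≤; *-monoʳ-≤;
         +-monoˡ-≤; ^-distribˡ-+-*; ^-monoʳ-≤; m^n>0; m+[n∸m]≡n; ≤ᵇ⇒≤; module ≤-Reasoning)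
  renaming (_≟_ to _≟ℕ_)
open import Data.Nat.DivMod using (_/_; _%_; m≡m%n+[m/n]*n; m%n<n)
open import Data.Nat.Solver using (module +-*-Solver)
open import Data.Bool using (Bool; T)
open import Data.Bool.ListAction using (all; any)
open import Data.Bool.Properties using (T?) renaming (_≟_ to _≟ᵇ_)
open import Data.Fin using (Fin; _↑ˡ_; _↑ʳ_; splitAt; quotient; #_) renaming (_≟_ to _≟ᶠ_)
open import Data.Fin.Properties using (splitAt-↑ˡ; splitAt-↑ʳ; splitAt⁻¹-↑ˡ; splitAt⁻¹-↑ʳ)
open import Data.Fin.Subset using (Subset; Side; inside; outside; _∈_; _⊂_; _∩_; ⁅_⁆; ∣_∣)
  renaming (⊥ to ∅)
open import Data.Fin.Subset.Properties using (_∈?_; ∉⊥; ∣⊥∣≡0; x∈p∩q⁺; x∈⁅y⁆⇒x≡y)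
open import Data.Vec using ([]; _∷_; _++_; lookup)
import Data.Vec as Vec
open import Data.Vec.Properties using (lookup-++ˡ; lookup-++ʳ; lookup⇒[]=; []=⇒lookup; ++-injective; ≡-dec)
open import Data.List using (List; []; _∷_; length; allFin; map; cartesianProductWith)
  renaming (_++_ to _++ₗ_)
open import Data.List.Properties using (length-++; length-map)
open import Data.List.Membership.Propositional using (find) renaming (_∈_ to _∈ₗ_)
open import Data.List.Membership.Propositional.Properties using (∈-allFin; ∈-cartesianProductWith⁻)
open import Data.List.Relation.Unary.All as All using (All)
open import Data.List.Relation.Unary.All.Properties using (all⁺)
open import Data.List.Relation.Unary.Any.Properties using (any⁻)
import Data.List.Relation.Unary.AllPairs as AllPairs
open import Data.List.Relation.Unary.Linked using (Linked; linked?)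
open import Data.List.Relation.Unary.Linked.Properties using (Linked⇒AllPairs)
open import Data.List.Relation.Unary.Unique.Propositional using (Unique)
import Data.List.Relation.Unary.Unique.Propositional.Properties as Unique
open import Data.Product using (Σ; ∃; _×_; _,_; proj₁; proj₂)
open import Data.Sum using (_⊎_; inj₁; inj₂; [_,_]′)
open import Data.Empty using (⊥-elim)
open import Data.Unit using (tt)
open import Relation.Binary.PropositionalEquality
  using (_≡_; refl; sym; trans; cong; cong₂; subst; module ≡-Reasoning)
open import Relation.Nullary using (¬_; Dec)
open import Relation.Nullary.Decidable using (True; ⌊_⌋; toWitness; _×-dec_; _→-dec_)

left-or-right : ∀ m {k} (u : Fin (m + k)) → (∃ λ x → x ↑ˡ k ≡ u) ⊎ (∃ λ y → m ↑ʳ y ≡ u)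
left-or-right m u with splitAt m u in eq
... | inj₁ x = inj₁ (x , splitAt⁻¹-↑ˡ eq)
... | inj₂ y = inj₂ (y , splitAt⁻¹-↑ʳ eq)

module _ {m k : ℕ} {p : Subset m} {q : Subset k} where

  ∈-++⁺ˡ : ∀ {x} → x ∈ p → x ↑ˡ k ∈ p ++ q
  ∈-++⁺ˡ {x} x∈p = lookup⇒[]= (x ↑ˡ k) (p ++ q) (trans (lookup-++ˡ p q x) ([]=⇒lookup x∈p))

  ∈-++⁻ˡ : ∀ {x} → x ↑ˡ k ∈ p ++ q → x ∈ p
  ∈-++⁻ˡ {x} x∈p++q = lookup⇒[]= x p (trans (sym (lookup-++ˡ p q x)) ([]=⇒lookup x∈p++q))

  ∈-++⁺ʳ : ∀ {y} → y ∈ q → m ↑ʳ y ∈ p ++ q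
  ∈-++⁺ʳ {y} y∈q = lookup⇒[]= (m ↑ʳ y) (p ++ q) (trans (lookup-++ʳ p q y) ([]=⇒lookup y∈q))

  ∈-++⁻ʳ : ∀ {y} → m ↑ʳ y ∈ p ++ q → y ∈ q
  ∈-++⁻ʳ {y} y∈p++q = lookup⇒[]= y q (trans (sym (lookup-++ʳ p q y)) ([]=⇒lookup y∈p++q))

∈-padded-left : ∀ {m k} (p : Subset m) {u} → u ∈ p ++ ∅ {k} → ∃ λ x → x ↑ˡ k ≡ u × x ∈ p
∈-padded-left {m} {k} p {u} u∈ with left-or-right m u
... | inj₁ (x , refl) = x , refl , ∈-++⁻ˡ u∈
... | inj₂ (y , refl) = ⊥-elim (∉⊥ (∈-++⁻ʳ {m} {k} {p} {∅} u∈))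

∈-padded-right : ∀ {m k} (q : Subset k) {u} → u ∈ ∅ {m} ++ q → ∃ λ y → m ↑ʳ y ≡ u × y ∈ q
∈-padded-right {m} {k} q {u} u∈ with left-or-right m u
... | inj₁ (x , refl) = ⊥-elim (∉⊥ (∈-++⁻ˡ {m} {k} {∅} {q} u∈))
... | inj₂ (y , refl) = y , refl , ∈-++⁻ʳ u∈

∣p++q∣ : ∀ {m k} (p : Subset m) (q : Subset k) → ∣ p ++ q ∣ ≡ ∣ p ∣ + ∣ q ∣
∣p++q∣ []            q = refl
∣p++q∣ (inside ∷ p)  q = cong suc (∣p++q∣ p q)
∣p++q∣ (outside ∷ p) q = ∣p++q∣ p q

++-⊂ : ∀ {m k} {p₁ q₁ : Subset m} {p₂ q₂ : Subset k} →
       p₁ ++ p₂ ⊂ q₁ ++ q₂ → p₁ ⊂ q₁ ⊎ p₂ ⊂ q₂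
++-⊂ {m} (p⊆q , u , u∈q , u∉p) with left-or-right m u
... | inj₁ (x , refl) =
  inj₁ ((λ x∈p₁ → ∈-++⁻ˡ (p⊆q (∈-++⁺ˡ x∈p₁))) ,
        x , ∈-++⁻ˡ u∈q , λ x∈p₁ → u∉p (∈-++⁺ˡ x∈p₁))
... | inj₂ (y , refl) =
  inj₂ ((λ y∈p₂ → ∈-++⁻ʳ (p⊆q (∈-++⁺ʳ y∈p₂))) ,
        y , ∈-++⁻ʳ u∈q , λ y∈p₂ → u∉p (∈-++⁺ʳ y∈p₂))

data UnionEdge {m k} (E₁ : EdgeFamily m) (E₂ : EdgeFamily k) : Subset (m + k) → Set where
  left  : ∀ {e} → E₁ e → UnionEdge E₁ E₂ (e ++ ∅)
  right : ∀ {e} → E₂ e → UnionEdge E₁ E₂ (∅ ++ e)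

module DisjointUnion {m k} (H₁ : Tri3Hypergraph m) (H₂ : Tri3Hypergraph k) where
  open Tri3Hypergraph H₁
    renaming (edge to E₁; covers to covers₁; uniform to uniform₁; tripartite to tripartite₁)
  open Tri3Hypergraph H₂
    renaming (edge to E₂; covers to covers₂; uniform to uniform₂; tripartite to tripartite₂)

  E : EdgeFamily (m + k)
  E = UnionEdge E₁ E₂

  covers : Covers E
  covers u with left-or-right m u
  ... | inj₁ (x , refl) = let (e , e∈E₁ , x∈e) = covers₁ x in e ++ ∅ , left e∈E₁ , ∈-++⁺ˡ x∈e
  ... | inj₂ (y , refl) = let (e , e∈E₂ , y∈e) = covers₂ y in ∅ ++ e , right e∈E₂ , ∈-++⁺ʳ y∈e

  uniform : ThreeUniform E
  uniform _ (left {e} e∈E₁) = begin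
    ∣ e ++ ∅ ∣           ≡⟨ ∣p++q∣ e (∅ {k}) ⟩
    ∣ e ∣ + ∣ ∅ {k} ∣    ≡⟨ cong (∣ e ∣ +_) (∣⊥∣≡0 k) ⟩
    ∣ e ∣ + 0            ≡⟨ +-identityʳ ∣ e ∣ ⟩
    ∣ e ∣                ≡⟨ uniform₁ e e∈E₁ ⟩
    3                    ∎
    where open ≡-Reasoning
  uniform _ (right {e} e∈E₂) = begin
    ∣ ∅ {m} ++ e ∣       ≡⟨ ∣p++q∣ (∅ {m}) e ⟩
    ∣ ∅ {m} ∣ + ∣ e ∣    ≡⟨ cong (_+ ∣ e ∣) (∣⊥∣≡0 m) ⟩
    ∣ e ∣                ≡⟨ uniform₂ e e∈E₂ ⟩
    3                    ∎
    where open ≡-Reasoning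

  class : Fin (m + k) → Fin 3
  class u = [ proj₁ tripartite₁ , proj₁ tripartite₂ ]′ (splitAt m u)

  class-left : ∀ x → class (x ↑ˡ k) ≡ proj₁ tripartite₁ x
  class-left x = cong [ proj₁ tripartite₁ , proj₁ tripartite₂ ]′ (splitAt-↑ˡ m x k)

  class-right : ∀ y → class (m ↑ʳ y) ≡ proj₁ tripartite₂ y
  class-right y = cong [ proj₁ tripartite₁ , proj₁ tripartite₂ ]′ (splitAt-↑ʳ m k y)

  -- The vertices of an edge of the union lie in one part, where the classes
  -- already separate them.
  separated : ∀ e → E e → ∀ u v → u ∈ e → v ∈ e → class u ≡ class v → u ≡ v
  separated _ (left {e} e∈E₁) u v u∈e v∈e same with ∈-padded-left e u∈e | ∈-padded-left e v∈e
  ... | x , refl , x∈e | y , refl , y∈e =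
    cong (_↑ˡ k) (proj₂ tripartite₁ _ e∈E₁ x y x∈e y∈e
                    (trans (sym (class-left x)) (trans same (class-left y))))
  separated _ (right {e} e∈E₂) u v u∈e v∈e same with ∈-padded-right e u∈e | ∈-padded-right e v∈e
  ... | x , refl , x∈e | y , refl , y∈e =
    cong (m ↑ʳ_) (proj₂ tripartite₂ _ e∈E₂ x y x∈e y∈e
                    (trans (sym (class-right x)) (trans same (class-right y))))

  hypergraph : Tri3Hypergraph (m + k)
  hypergraph = record { edge = E ; covers = covers ; uniform = uniform ; tripartite = class , separated }

  transversal-++ : ∀ {T₁ T₂} → Transversal E₁ T₁ → Transversal E₂ T₂ → Transversal E (T₁ ++ T₂)
  transversal-++ tr₁ tr₂ _ (left e∈E₁) =
    let (x , x∈e , x∈T) = tr₁ _ e∈E₁ in x ↑ˡ k , ∈-++⁺ˡ x∈e , ∈-++⁺ˡ x∈T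
  transversal-++ tr₁ tr₂ _ (right e∈E₂) =
    let (y , y∈e , y∈T) = tr₂ _ e∈E₂ in m ↑ʳ y , ∈-++⁺ʳ y∈e , ∈-++⁺ʳ y∈T

  restrictˡ : ∀ {S₁ S₂} → Transversal E (S₁ ++ S₂) → Transversal E₁ S₁
  restrictˡ tr e e∈E₁ with tr (e ++ ∅) (left e∈E₁)
  ... | u , u∈e , u∈S with ∈-padded-left e u∈e
  ...   | x , refl , x∈e = x , x∈e , ∈-++⁻ˡ u∈S

  restrictʳ : ∀ {S₁ S₂} → Transversal E (S₁ ++ S₂) → Transversal E₂ S₂
  restrictʳ tr e e∈E₂ with tr (∅ ++ e) (right e∈E₂)
  ... | u , u∈e , u∈S with ∈-padded-right e u∈e
  ...   | y , refl , y∈e = y , y∈e , ∈-++⁻ʳ u∈S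

  -- Minimal transversals of the parts combine into one of the union: a
  -- smaller transversal would be strictly smaller on one of the parts.
  minimal-++ : ∀ {T₁ T₂} → MinimalTransversal E₁ T₁ → MinimalTransversal E₂ T₂ →
               MinimalTransversal E (T₁ ++ T₂)
  minimal-++ {T₁} {T₂} (tr₁ , min₁) (tr₂ , min₂) = transversal-++ tr₁ tr₂ , no-smaller
    where
    no-smaller : ∀ S → S ⊂ T₁ ++ T₂ → ¬ Transversal E S
    no-smaller S S⊂T trS with Vec.splitAt m S
    ... | S₁ , S₂ , refl with ++-⊂ S⊂T
    ...   | inj₁ S₁⊂T₁ = min₁ S₁ S₁⊂T₁ (restrictˡ trS)
    ...   | inj₂ S₂⊂T₂ = min₂ S₂ S₂⊂T₂ (restrictʳ trS)

_⊕_ : ∀ {m k} → Tri3Hypergraph m → Tri3Hypergraph k → Tri3Hypergraph (m + k)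
_⊕_ = DisjointUnion.hypergraph

-- A witness for f₃(n) ≥ c: a tripartite 3-uniform hypergraph of order n with
-- a list of at least c distinct minimal transversals.
record Witness (n c : ℕ) : Set₁ where
  field
    hypergraph   : Tri3Hypergraph n
    transversals : List (Subset n)
    distinct     : Unique transversals
    minimal      : All (MinimalTransversal (Tri3Hypergraph.edge hypergraph)) transversals
    enough       : c ≤ length transversals

length-cartesianProductWith : ∀ {A B C : Set} (f : A → B → C) xs ys →
                              length (cartesianProductWith f xs ys) ≡ length xs * length ys
length-cartesianProductWith f []       ys = refl
length-cartesianProductWith f (x ∷ xs) ys = begin
  length (map (f x) ys ++ₗ cartesianProductWith f xs ys)          ≡⟨ length-++ (map (f x) ys) ⟩
  length (map (f x) ys) + length (cartesianProductWith f xs ys)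
    ≡⟨ cong₂ _+_ (length-map (f x) ys) (length-cartesianProductWith f xs ys) ⟩
  length ys + length xs * length ys                               ∎
  where open ≡-Reasoning

_⊗_ : ∀ {m k c d} → Witness m c → Witness k d → Witness (m + k) (c * d)
_⊗_ {c = c} {d} W₁ W₂ = record
  { hypergraph   = H₁ ⊕ H₂
  ; transversals = products
  ; distinct     = Unique.cartesianProductWith⁺ _++_ (λ {w} {x} eq → ++-injective w x eq)
                                                  distinct₁ distinct₂
  ; minimal      = All.tabulate minimal-product
  ; enough       = subst (c * d ≤_) (sym (length-cartesianProductWith _++_ L₁ L₂))
                         (*-mono-≤ enough₁ enough₂)
  }
  where
  open Witness W₁ renaming (hypergraph to H₁; transversals to L₁; distinct to distinct₁;
                            minimal to minimal₁; enough to enough₁)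
  open Witness W₂ renaming (hypergraph to H₂; transversals to L₂; distinct to distinct₂;
                            minimal to minimal₂; enough to enough₂)

  products : List (Subset _)
  products = cartesianProductWith _++_ L₁ L₂

  minimal-product : ∀ {T} → T ∈ₗ products → MinimalTransversal (Tri3Hypergraph.edge (H₁ ⊕ H₂)) T
  minimal-product T∈ with ∈-cartesianProductWith⁻ _++_ L₁ L₂ T∈
  ... | T₁ , T₂ , T₁∈ , T₂∈ , refl =
    DisjointUnion.minimal-++ H₁ H₂ (All.lookup minimal₁ T₁∈) (All.lookup minimal₂ T₂∈)

-- Private-edge criterion: a transversal T in which every vertex x has an edge
-- meeting T exactly in x is minimal, since dropping x leaves that edge unhit.
private-edges⇒minimal : ∀ {n} {E : EdgeFamily n} {T : Subset n} → Transversal E T →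
                        (∀ x → x ∈ T → ∃ λ e → E e × e ∩ T ≡ ⁅ x ⁆) → MinimalTransversal E T
private-edges⇒minimal {T = T} trT private-edge = trT , no-smaller
  where
  no-smaller : ∀ S → S ⊂ T → ¬ Transversal _ S
  no-smaller S (S⊆T , x , x∈T , x∉S) trS =
    let (e , e∈E , e∩T≡x) = private-edge x x∈T
        (y , y∈e , y∈S)   = trS e e∈E
        y≡x               = x∈⁅y⁆⇒x≡y x (subst (y ∈_) e∩T≡x (x∈p∩q⁺ (y∈e , S⊆T y∈S)))
    in x∉S (subst (_∈ S) y≡x y∈S)

increasing⇒unique : ∀ {A : Set} (f : A → ℕ) {xs} → Linked (λ x y → f x < f y) xs → Unique xs
increasing⇒unique f increasing =
  AllPairs.map (λ fx<fy x≡y → <-irrefl (cong f x≡y) fx<fy) (Linked⇒AllPairs <-trans increasing)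

-- The number whose binary digits (least significant first) are the
-- membership bits; listing subsets with increasing codes certifies that they
-- are distinct.
binary : ∀ {n} → Subset n → ℕ
binary []            = 0
binary (inside ∷ p)  = 1 + 2 * binary p
binary (outside ∷ p) = 2 * binary p

module _ {A : Set} (p : A → Bool) where

  all-sound : ∀ {xs} → T (all p xs) → ∀ {x} → x ∈ₗ xs → T (p x)
  all-sound {xs} holds = All.lookup (all⁺ p xs holds)

  any-sound : ∀ {xs} → T (any p xs) → ∃ λ x → x ∈ₗ xs × T (p x)
  any-sound {xs} holds = find (any⁻ p xs holds)

module _ {n} (p : Fin n → Bool) where

  forallV existsV : Bool
  forallV = all p (allFin n)
  existsV = any p (allFin n)

  forallV-sound : T forallV → ∀ v → T (p v)
  forallV-sound holds v = all-sound p {allFin n} holds (∈-allFin v)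

  existsV-sound : T existsV → ∃ λ v → T (p v)
  existsV-sound holds = let (v , _ , pv) = any-sound p {allFin n} holds in v , pv

infix 4 _≟ₛ_
_≟ₛ_ : ∀ {n} (p q : Subset n) → Dec (p ≡ q)
_≟ₛ_ = ≡-dec _≟ᵇ_

module Certificate {n} (edges : List (Subset n)) where

  IsEdge : EdgeFamily n
  IsEdge e = e ∈ₗ edges

  covers? : Bool
  covers? = forallV λ v → any (λ e → ⌊ v ∈? e ⌋) edges

  covers-sound : T covers? → Covers IsEdge
  covers-sound holds v =
    let (e , e∈ , v∈e) = any-sound _ (forallV-sound _ holds v) in e , e∈ , toWitness v∈e

  uniform? : Bool
  uniform? = all (λ e → ⌊ ∣ e ∣ ≟ℕ 3 ⌋) edges

  uniform-sound : T uniform? → ThreeUniform IsEdge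
  uniform-sound holds e e∈ = toWitness (all-sound _ holds e∈)

  separated? : (Fin n → Fin 3) → Bool
  separated? class = all (λ e → forallV λ u → forallV λ v →
    ⌊ u ∈? e →-dec v ∈? e →-dec class u ≟ᶠ class v →-dec u ≟ᶠ v ⌋) edges

  separated-sound : ∀ class → T (separated? class) → Tripartite IsEdge
  separated-sound class holds =
    class , λ e e∈ u v → toWitness (forallV-sound _ (forallV-sound _ (all-sound _ holds e∈) u) v)

  transversal? : Subset n → Bool
  transversal? X = all (λ e → existsV λ v → ⌊ v ∈? e ×-dec v ∈? X ⌋) edges

  transversal-sound : ∀ X → T (transversal? X) → Transversal IsEdge X
  transversal-sound X holds e e∈ =
    let (v , v∈e∩X) = existsV-sound _ (all-sound _ holds e∈) in v , toWitness v∈e∩X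

  private-edges? : Subset n → Bool
  private-edges? X =
    forallV λ x → ⌊ x ∈? X →-dec T? (any (λ e → ⌊ e ∩ X ≟ₛ ⁅ x ⁆ ⌋) edges) ⌋

  private-edges-sound : ∀ X → T (private-edges? X) →
                        ∀ x → x ∈ X → ∃ λ e → IsEdge e × e ∩ X ≡ ⁅ x ⁆
  private-edges-sound X holds x x∈X =
    let (e , e∈ , e∩X≡x) = any-sound _ (toWitness (forallV-sound _ holds x) x∈X)
    in e , e∈ , toWitness e∩X≡x

  certify : (class : Fin n → Fin 3) (L : List (Subset n)) →
            T covers? → T uniform? → T (separated? class) →
            T (all transversal? L) → T (all private-edges? L) →
            True (linked? (λ S S′ → binary S <? binary S′) L) → Witness n (length L)
  certify class L cov uni sep tr pr increasing = record
    { hypergraph   = record { edge = IsEdge ; covers = covers-sound cov ; uniform = uniform-sound uni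
                            ; tripartite = separated-sound class sep }
    ; transversals = L
    ; distinct     = increasing⇒unique binary (toWitness increasing)
    ; minimal      = All.tabulate λ {X} X∈L →
                       private-edges⇒minimal (transversal-sound X (all-sound _ tr X∈L))
                                             (private-edges-sound X (all-sound _ pr X∈L))
    ; enough       = ≤-refl
    }

I O : Side
I = inside
O = outside

witness₀ : Witness 0 1
witness₀ = Certificate.certify [] (λ ()) ([] ∷ []) _ _ _ _ _ _

witness₃ : Witness 3 1
witness₃ = Certificate.certify
  ((I ∷ I ∷ I ∷ []) ∷ [])
  (lookup (# 0 ∷ # 1 ∷ # 2 ∷ []))
  ((I ∷ O ∷ O ∷ []) ∷ [])
  _ _ _ _ _ _

witness₄ : Witness 4 1
witness₄ = Certificate.certify
  ((I ∷ I ∷ I ∷ O ∷ []) ∷ (I ∷ I ∷ O ∷ I ∷ []) ∷ [])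
  (lookup (# 0 ∷ # 1 ∷ # 2 ∷ # 2 ∷ []))
  ((I ∷ O ∷ O ∷ O ∷ []) ∷ [])
  _ _ _ _ _ _

witness₅ : Witness 5 1
witness₅ = Certificate.certify
  ((I ∷ I ∷ I ∷ O ∷ O ∷ []) ∷ (I ∷ O ∷ O ∷ I ∷ I ∷ []) ∷ [])
  (lookup (# 0 ∷ # 1 ∷ # 2 ∷ # 1 ∷ # 2 ∷ []))
  ((I ∷ O ∷ O ∷ O ∷ O ∷ []) ∷ [])
  _ _ _ _ _ _

-- Vertex 5c + i is the i-th vertex of class
-- c (so the classes are the blocks of five consecutive vertices, and the class
-- of a vertex is its quotient by 5); the edges are {aᵢ, bⱼ, c_{i+j mod 5}},
-- listed in the order (i, j) = (0, 0), (0, 1), …, (4, 4).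
latin-edges : List (Subset 15)
latin-edges =
  (I ∷ O ∷ O ∷ O ∷ O ∷ I ∷ O ∷ O ∷ O ∷ O ∷ I ∷ O ∷ O ∷ O ∷ O ∷ []) ∷
  (I ∷ O ∷ O ∷ O ∷ O ∷ O ∷ I ∷ O ∷ O ∷ O ∷ O ∷ I ∷ O ∷ O ∷ O ∷ []) ∷
  (I ∷ O ∷ O ∷ O ∷ O ∷ O ∷ O ∷ I ∷ O ∷ O ∷ O ∷ O ∷ I ∷ O ∷ O ∷ []) ∷
  (I ∷ O ∷ O ∷ O ∷ O ∷ O ∷ O ∷ O ∷ I ∷ O ∷ O ∷ O ∷ O ∷ I ∷ O ∷ []) ∷
  (I ∷ O ∷ O ∷ O ∷ O ∷ O ∷ O ∷ O ∷ O ∷ I ∷ O ∷ O ∷ O ∷ O ∷ I ∷ []) ∷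
  (O ∷ I ∷ O ∷ O ∷ O ∷ I ∷ O ∷ O ∷ O ∷ O ∷ O ∷ I ∷ O ∷ O ∷ O ∷ []) ∷
  (O ∷ I ∷ O ∷ O ∷ O ∷ O ∷ I ∷ O ∷ O ∷ O ∷ O ∷ O ∷ I ∷ O ∷ O ∷ []) ∷
  (O ∷ I ∷ O ∷ O ∷ O ∷ O ∷ O ∷ I ∷ O ∷ O ∷ O ∷ O ∷ O ∷ I ∷ O ∷ []) ∷
  (O ∷ I ∷ O ∷ O ∷ O ∷ O ∷ O ∷ O ∷ I ∷ O ∷ O ∷ O ∷ O ∷ O ∷ I ∷ []) ∷
  (O ∷ I ∷ O ∷ O ∷ O ∷ O ∷ O ∷ O ∷ O ∷ I ∷ I ∷ O ∷ O ∷ O ∷ O ∷ []) ∷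
  (O ∷ O ∷ I ∷ O ∷ O ∷ I ∷ O ∷ O ∷ O ∷ O ∷ O ∷ O ∷ I ∷ O ∷ O ∷ []) ∷
  (O ∷ O ∷ I ∷ O ∷ O ∷ O ∷ I ∷ O ∷ O ∷ O ∷ O ∷ O ∷ O ∷ I ∷ O ∷ []) ∷
  (O ∷ O ∷ I ∷ O ∷ O ∷ O ∷ O ∷ I ∷ O ∷ O ∷ O ∷ O ∷ O ∷ O ∷ I ∷ []) ∷
  (O ∷ O ∷ I ∷ O ∷ O ∷ O ∷ O ∷ O ∷ I ∷ O ∷ I ∷ O ∷ O ∷ O ∷ O ∷ []) ∷
  (O ∷ O ∷ I ∷ O ∷ O ∷ O ∷ O ∷ O ∷ O ∷ I ∷ O ∷ I ∷ O ∷ O ∷ O ∷ []) ∷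
  (O ∷ O ∷ O ∷ I ∷ O ∷ I ∷ O ∷ O ∷ O ∷ O ∷ O ∷ O ∷ O ∷ I ∷ O ∷ []) ∷
  (O ∷ O ∷ O ∷ I ∷ O ∷ O ∷ I ∷ O ∷ O ∷ O ∷ O ∷ O ∷ O ∷ O ∷ I ∷ []) ∷
  (O ∷ O ∷ O ∷ I ∷ O ∷ O ∷ O ∷ I ∷ O ∷ O ∷ I ∷ O ∷ O ∷ O ∷ O ∷ []) ∷
  (O ∷ O ∷ O ∷ I ∷ O ∷ O ∷ O ∷ O ∷ I ∷ O ∷ O ∷ I ∷ O ∷ O ∷ O ∷ []) ∷
  (O ∷ O ∷ O ∷ I ∷ O ∷ O ∷ O ∷ O ∷ O ∷ I ∷ O ∷ O ∷ I ∷ O ∷ O ∷ []) ∷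
  (O ∷ O ∷ O ∷ O ∷ I ∷ I ∷ O ∷ O ∷ O ∷ O ∷ O ∷ O ∷ O ∷ O ∷ I ∷ []) ∷
  (O ∷ O ∷ O ∷ O ∷ I ∷ O ∷ I ∷ O ∷ O ∷ O ∷ I ∷ O ∷ O ∷ O ∷ O ∷ []) ∷
  (O ∷ O ∷ O ∷ O ∷ I ∷ O ∷ O ∷ I ∷ O ∷ O ∷ O ∷ I ∷ O ∷ O ∷ O ∷ []) ∷
  (O ∷ O ∷ O ∷ O ∷ I ∷ O ∷ O ∷ O ∷ I ∷ O ∷ O ∷ O ∷ I ∷ O ∷ O ∷ []) ∷
  (O ∷ O ∷ O ∷ O ∷ I ∷ O ∷ O ∷ O ∷ O ∷ I ∷ O ∷ O ∷ O ∷ I ∷ O ∷ []) ∷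
  []

latin-minimal : List (Subset 15)
latin-minimal =
  (I ∷ I ∷ I ∷ I ∷ I ∷ O ∷ O ∷ O ∷ O ∷ O ∷ O ∷ O ∷ O ∷ O ∷ O ∷ []) ∷
  (O ∷ O ∷ O ∷ O ∷ O ∷ I ∷ I ∷ I ∷ I ∷ I ∷ O ∷ O ∷ O ∷ O ∷ O ∷ []) ∷
  (I ∷ O ∷ I ∷ I ∷ I ∷ I ∷ I ∷ I ∷ I ∷ O ∷ I ∷ O ∷ O ∷ O ∷ O ∷ []) ∷
  (I ∷ I ∷ O ∷ I ∷ I ∷ I ∷ I ∷ I ∷ O ∷ I ∷ I ∷ O ∷ O ∷ O ∷ O ∷ []) ∷
  (I ∷ I ∷ I ∷ O ∷ I ∷ I ∷ I ∷ O ∷ I ∷ I ∷ I ∷ O ∷ O ∷ O ∷ O ∷ []) ∷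
  (I ∷ I ∷ I ∷ I ∷ O ∷ I ∷ O ∷ I ∷ I ∷ I ∷ I ∷ O ∷ O ∷ O ∷ O ∷ []) ∷
  (O ∷ I ∷ I ∷ I ∷ I ∷ O ∷ I ∷ I ∷ I ∷ I ∷ I ∷ O ∷ O ∷ O ∷ O ∷ []) ∷
  (I ∷ I ∷ O ∷ I ∷ I ∷ I ∷ I ∷ I ∷ I ∷ O ∷ O ∷ I ∷ O ∷ O ∷ O ∷ []) ∷
  (I ∷ I ∷ I ∷ O ∷ I ∷ I ∷ I ∷ I ∷ O ∷ I ∷ O ∷ I ∷ O ∷ O ∷ O ∷ []) ∷
  (I ∷ I ∷ I ∷ I ∷ O ∷ I ∷ I ∷ O ∷ I ∷ I ∷ O ∷ I ∷ O ∷ O ∷ O ∷ []) ∷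
  (O ∷ I ∷ I ∷ I ∷ I ∷ I ∷ O ∷ I ∷ I ∷ I ∷ O ∷ I ∷ O ∷ O ∷ O ∷ []) ∷
  (I ∷ O ∷ I ∷ I ∷ I ∷ O ∷ I ∷ I ∷ I ∷ I ∷ O ∷ I ∷ O ∷ O ∷ O ∷ []) ∷
  (I ∷ I ∷ O ∷ I ∷ I ∷ I ∷ I ∷ I ∷ O ∷ O ∷ I ∷ I ∷ O ∷ O ∷ O ∷ []) ∷
  (I ∷ O ∷ I ∷ I ∷ I ∷ O ∷ I ∷ I ∷ I ∷ O ∷ I ∷ I ∷ O ∷ O ∷ O ∷ []) ∷
  (I ∷ O ∷ O ∷ I ∷ I ∷ I ∷ I ∷ I ∷ I ∷ O ∷ I ∷ I ∷ O ∷ O ∷ O ∷ []) ∷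
  (I ∷ I ∷ I ∷ O ∷ I ∷ I ∷ I ∷ O ∷ O ∷ I ∷ I ∷ I ∷ O ∷ O ∷ O ∷ []) ∷
  (I ∷ I ∷ O ∷ O ∷ I ∷ I ∷ I ∷ I ∷ O ∷ I ∷ I ∷ I ∷ O ∷ O ∷ O ∷ []) ∷
  (I ∷ I ∷ I ∷ I ∷ O ∷ I ∷ O ∷ O ∷ I ∷ I ∷ I ∷ I ∷ O ∷ O ∷ O ∷ []) ∷
  (I ∷ I ∷ I ∷ O ∷ O ∷ I ∷ I ∷ O ∷ I ∷ I ∷ I ∷ I ∷ O ∷ O ∷ O ∷ []) ∷
  (O ∷ I ∷ I ∷ I ∷ I ∷ O ∷ O ∷ I ∷ I ∷ I ∷ I ∷ I ∷ O ∷ O ∷ O ∷ []) ∷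
  (O ∷ I ∷ I ∷ I ∷ O ∷ I ∷ O ∷ I ∷ I ∷ I ∷ I ∷ I ∷ O ∷ O ∷ O ∷ []) ∷
  (O ∷ O ∷ I ∷ I ∷ I ∷ O ∷ I ∷ I ∷ I ∷ I ∷ I ∷ I ∷ O ∷ O ∷ O ∷ []) ∷
  (I ∷ I ∷ I ∷ O ∷ I ∷ I ∷ I ∷ I ∷ I ∷ O ∷ O ∷ O ∷ I ∷ O ∷ O ∷ []) ∷
  (I ∷ I ∷ I ∷ I ∷ O ∷ I ∷ I ∷ I ∷ O ∷ I ∷ O ∷ O ∷ I ∷ O ∷ O ∷ []) ∷
  (O ∷ I ∷ I ∷ I ∷ I ∷ I ∷ I ∷ O ∷ I ∷ I ∷ O ∷ O ∷ I ∷ O ∷ O ∷ []) ∷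
  (I ∷ O ∷ I ∷ I ∷ I ∷ I ∷ O ∷ I ∷ I ∷ I ∷ O ∷ O ∷ I ∷ O ∷ O ∷ []) ∷
  (I ∷ I ∷ O ∷ I ∷ I ∷ O ∷ I ∷ I ∷ I ∷ I ∷ O ∷ O ∷ I ∷ O ∷ O ∷ []) ∷
  (I ∷ I ∷ I ∷ O ∷ I ∷ I ∷ I ∷ O ∷ I ∷ O ∷ I ∷ O ∷ I ∷ O ∷ O ∷ []) ∷
  (I ∷ O ∷ I ∷ I ∷ I ∷ I ∷ O ∷ I ∷ I ∷ O ∷ I ∷ O ∷ I ∷ O ∷ O ∷ []) ∷
  (I ∷ O ∷ I ∷ O ∷ I ∷ I ∷ I ∷ I ∷ I ∷ O ∷ I ∷ O ∷ I ∷ O ∷ O ∷ []) ∷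
  (I ∷ I ∷ I ∷ I ∷ O ∷ I ∷ O ∷ I ∷ O ∷ I ∷ I ∷ O ∷ I ∷ O ∷ O ∷ []) ∷
  (I ∷ I ∷ O ∷ I ∷ I ∷ O ∷ I ∷ I ∷ O ∷ I ∷ I ∷ O ∷ I ∷ O ∷ O ∷ []) ∷
  (I ∷ I ∷ O ∷ I ∷ O ∷ I ∷ I ∷ I ∷ O ∷ I ∷ I ∷ O ∷ I ∷ O ∷ O ∷ []) ∷
  (O ∷ I ∷ I ∷ I ∷ I ∷ O ∷ I ∷ O ∷ I ∷ I ∷ I ∷ O ∷ I ∷ O ∷ O ∷ []) ∷
  (O ∷ I ∷ I ∷ O ∷ I ∷ I ∷ I ∷ O ∷ I ∷ I ∷ I ∷ O ∷ I ∷ O ∷ O ∷ []) ∷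
  (I ∷ O ∷ I ∷ I ∷ O ∷ I ∷ O ∷ I ∷ I ∷ I ∷ I ∷ O ∷ I ∷ O ∷ O ∷ []) ∷
  (O ∷ I ∷ O ∷ I ∷ I ∷ O ∷ I ∷ I ∷ I ∷ I ∷ I ∷ O ∷ I ∷ O ∷ O ∷ []) ∷
  (I ∷ I ∷ I ∷ O ∷ I ∷ I ∷ I ∷ I ∷ O ∷ O ∷ O ∷ I ∷ I ∷ O ∷ O ∷ []) ∷
  (I ∷ I ∷ O ∷ I ∷ I ∷ O ∷ I ∷ I ∷ I ∷ O ∷ O ∷ I ∷ I ∷ O ∷ O ∷ []) ∷
  (I ∷ I ∷ O ∷ O ∷ I ∷ I ∷ I ∷ I ∷ I ∷ O ∷ O ∷ I ∷ I ∷ O ∷ O ∷ []) ∷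
  (I ∷ I ∷ I ∷ I ∷ O ∷ I ∷ I ∷ O ∷ O ∷ I ∷ O ∷ I ∷ I ∷ O ∷ O ∷ []) ∷
  (I ∷ I ∷ I ∷ O ∷ O ∷ I ∷ I ∷ I ∷ O ∷ I ∷ O ∷ I ∷ I ∷ O ∷ O ∷ []) ∷
  (O ∷ I ∷ I ∷ I ∷ I ∷ I ∷ O ∷ O ∷ I ∷ I ∷ O ∷ I ∷ I ∷ O ∷ O ∷ []) ∷
  (O ∷ I ∷ I ∷ I ∷ O ∷ I ∷ I ∷ O ∷ I ∷ I ∷ O ∷ I ∷ I ∷ O ∷ O ∷ []) ∷
  (I ∷ O ∷ I ∷ I ∷ I ∷ O ∷ O ∷ I ∷ I ∷ I ∷ O ∷ I ∷ I ∷ O ∷ O ∷ []) ∷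
  (O ∷ O ∷ I ∷ I ∷ I ∷ I ∷ O ∷ I ∷ I ∷ I ∷ O ∷ I ∷ I ∷ O ∷ O ∷ []) ∷
  (I ∷ O ∷ O ∷ I ∷ I ∷ O ∷ I ∷ I ∷ I ∷ I ∷ O ∷ I ∷ I ∷ O ∷ O ∷ []) ∷
  (I ∷ I ∷ I ∷ O ∷ I ∷ I ∷ I ∷ O ∷ O ∷ O ∷ I ∷ I ∷ I ∷ O ∷ O ∷ []) ∷
  (I ∷ I ∷ O ∷ I ∷ I ∷ O ∷ I ∷ I ∷ O ∷ O ∷ I ∷ I ∷ I ∷ O ∷ O ∷ []) ∷
  (I ∷ I ∷ O ∷ O ∷ I ∷ I ∷ I ∷ I ∷ O ∷ O ∷ I ∷ I ∷ I ∷ O ∷ O ∷ []) ∷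
  (I ∷ O ∷ I ∷ I ∷ I ∷ O ∷ O ∷ I ∷ I ∷ O ∷ I ∷ I ∷ I ∷ O ∷ O ∷ []) ∷
  (I ∷ O ∷ O ∷ I ∷ I ∷ O ∷ I ∷ I ∷ I ∷ O ∷ I ∷ I ∷ I ∷ O ∷ O ∷ []) ∷
  (I ∷ O ∷ O ∷ O ∷ I ∷ I ∷ I ∷ I ∷ I ∷ O ∷ I ∷ I ∷ I ∷ O ∷ O ∷ []) ∷
  (I ∷ I ∷ I ∷ I ∷ O ∷ I ∷ O ∷ O ∷ O ∷ I ∷ I ∷ I ∷ I ∷ O ∷ O ∷ []) ∷
  (I ∷ I ∷ I ∷ O ∷ O ∷ I ∷ I ∷ O ∷ O ∷ I ∷ I ∷ I ∷ I ∷ O ∷ O ∷ []) ∷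
  (I ∷ I ∷ O ∷ O ∷ O ∷ I ∷ I ∷ I ∷ O ∷ I ∷ I ∷ I ∷ I ∷ O ∷ O ∷ []) ∷
  (O ∷ I ∷ I ∷ I ∷ I ∷ O ∷ O ∷ O ∷ I ∷ I ∷ I ∷ I ∷ I ∷ O ∷ O ∷ []) ∷
  (O ∷ I ∷ I ∷ I ∷ O ∷ I ∷ O ∷ O ∷ I ∷ I ∷ I ∷ I ∷ I ∷ O ∷ O ∷ []) ∷
  (O ∷ I ∷ I ∷ O ∷ O ∷ I ∷ I ∷ O ∷ I ∷ I ∷ I ∷ I ∷ I ∷ O ∷ O ∷ []) ∷
  (O ∷ O ∷ I ∷ I ∷ I ∷ O ∷ O ∷ I ∷ I ∷ I ∷ I ∷ I ∷ I ∷ O ∷ O ∷ []) ∷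
  (O ∷ O ∷ I ∷ I ∷ O ∷ I ∷ O ∷ I ∷ I ∷ I ∷ I ∷ I ∷ I ∷ O ∷ O ∷ []) ∷
  (O ∷ O ∷ O ∷ I ∷ I ∷ O ∷ I ∷ I ∷ I ∷ I ∷ I ∷ I ∷ I ∷ O ∷ O ∷ []) ∷
  (I ∷ I ∷ I ∷ I ∷ O ∷ I ∷ I ∷ I ∷ I ∷ O ∷ O ∷ O ∷ O ∷ I ∷ O ∷ []) ∷
  (O ∷ I ∷ I ∷ I ∷ I ∷ I ∷ I ∷ I ∷ O ∷ I ∷ O ∷ O ∷ O ∷ I ∷ O ∷ []) ∷
  (I ∷ O ∷ I ∷ I ∷ I ∷ I ∷ I ∷ O ∷ I ∷ I ∷ O ∷ O ∷ O ∷ I ∷ O ∷ []) ∷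
  (I ∷ I ∷ O ∷ I ∷ I ∷ I ∷ O ∷ I ∷ I ∷ I ∷ O ∷ O ∷ O ∷ I ∷ O ∷ []) ∷
  (I ∷ I ∷ I ∷ O ∷ I ∷ O ∷ I ∷ I ∷ I ∷ I ∷ O ∷ O ∷ O ∷ I ∷ O ∷ []) ∷
  (I ∷ O ∷ I ∷ I ∷ I ∷ I ∷ I ∷ O ∷ I ∷ O ∷ I ∷ O ∷ O ∷ I ∷ O ∷ []) ∷
  (I ∷ I ∷ I ∷ I ∷ O ∷ I ∷ O ∷ I ∷ I ∷ O ∷ I ∷ O ∷ O ∷ I ∷ O ∷ []) ∷
  (I ∷ O ∷ I ∷ I ∷ O ∷ I ∷ I ∷ I ∷ I ∷ O ∷ I ∷ O ∷ O ∷ I ∷ O ∷ []) ∷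
  (I ∷ I ∷ O ∷ I ∷ I ∷ I ∷ O ∷ I ∷ O ∷ I ∷ I ∷ O ∷ O ∷ I ∷ O ∷ []) ∷
  (O ∷ I ∷ I ∷ I ∷ I ∷ O ∷ I ∷ I ∷ O ∷ I ∷ I ∷ O ∷ O ∷ I ∷ O ∷ []) ∷
  (O ∷ I ∷ O ∷ I ∷ I ∷ I ∷ I ∷ I ∷ O ∷ I ∷ I ∷ O ∷ O ∷ I ∷ O ∷ []) ∷
  (I ∷ I ∷ I ∷ O ∷ I ∷ O ∷ I ∷ O ∷ I ∷ I ∷ I ∷ O ∷ O ∷ I ∷ O ∷ []) ∷
  (I ∷ O ∷ I ∷ O ∷ I ∷ I ∷ I ∷ O ∷ I ∷ I ∷ I ∷ O ∷ O ∷ I ∷ O ∷ []) ∷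
  (I ∷ I ∷ O ∷ I ∷ O ∷ I ∷ O ∷ I ∷ I ∷ I ∷ I ∷ O ∷ O ∷ I ∷ O ∷ []) ∷
  (O ∷ I ∷ I ∷ O ∷ I ∷ O ∷ I ∷ I ∷ I ∷ I ∷ I ∷ O ∷ O ∷ I ∷ O ∷ []) ∷
  (I ∷ I ∷ I ∷ I ∷ O ∷ I ∷ I ∷ O ∷ I ∷ O ∷ O ∷ I ∷ O ∷ I ∷ O ∷ []) ∷
  (I ∷ I ∷ O ∷ I ∷ I ∷ I ∷ O ∷ I ∷ I ∷ O ∷ O ∷ I ∷ O ∷ I ∷ O ∷ []) ∷
  (I ∷ I ∷ O ∷ I ∷ O ∷ I ∷ I ∷ I ∷ I ∷ O ∷ O ∷ I ∷ O ∷ I ∷ O ∷ []) ∷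
  (O ∷ I ∷ I ∷ I ∷ I ∷ I ∷ O ∷ I ∷ O ∷ I ∷ O ∷ I ∷ O ∷ I ∷ O ∷ []) ∷
  (I ∷ I ∷ I ∷ O ∷ I ∷ O ∷ I ∷ I ∷ O ∷ I ∷ O ∷ I ∷ O ∷ I ∷ O ∷ []) ∷
  (O ∷ I ∷ I ∷ O ∷ I ∷ I ∷ I ∷ I ∷ O ∷ I ∷ O ∷ I ∷ O ∷ I ∷ O ∷ []) ∷
  (I ∷ O ∷ I ∷ I ∷ I ∷ O ∷ I ∷ O ∷ I ∷ I ∷ O ∷ I ∷ O ∷ I ∷ O ∷ []) ∷
  (I ∷ O ∷ I ∷ I ∷ O ∷ I ∷ I ∷ O ∷ I ∷ I ∷ O ∷ I ∷ O ∷ I ∷ O ∷ []) ∷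
  (O ∷ I ∷ O ∷ I ∷ I ∷ I ∷ O ∷ I ∷ I ∷ I ∷ O ∷ I ∷ O ∷ I ∷ O ∷ []) ∷
  (I ∷ O ∷ I ∷ O ∷ I ∷ O ∷ I ∷ I ∷ I ∷ I ∷ O ∷ I ∷ O ∷ I ∷ O ∷ []) ∷
  (I ∷ I ∷ O ∷ I ∷ I ∷ I ∷ O ∷ I ∷ O ∷ O ∷ I ∷ I ∷ O ∷ I ∷ O ∷ []) ∷
  (I ∷ I ∷ I ∷ I ∷ O ∷ I ∷ O ∷ O ∷ I ∷ O ∷ I ∷ I ∷ O ∷ I ∷ O ∷ []) ∷
  (I ∷ O ∷ I ∷ I ∷ I ∷ O ∷ I ∷ O ∷ I ∷ O ∷ I ∷ I ∷ O ∷ I ∷ O ∷ []) ∷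
  (I ∷ O ∷ I ∷ I ∷ O ∷ I ∷ I ∷ O ∷ I ∷ O ∷ I ∷ I ∷ O ∷ I ∷ O ∷ []) ∷
  (I ∷ I ∷ O ∷ I ∷ O ∷ I ∷ O ∷ I ∷ I ∷ O ∷ I ∷ I ∷ O ∷ I ∷ O ∷ []) ∷
  (I ∷ O ∷ O ∷ I ∷ O ∷ I ∷ I ∷ I ∷ I ∷ O ∷ I ∷ I ∷ O ∷ I ∷ O ∷ []) ∷
  (I ∷ I ∷ I ∷ O ∷ I ∷ O ∷ I ∷ O ∷ O ∷ I ∷ I ∷ I ∷ O ∷ I ∷ O ∷ []) ∷
  (O ∷ I ∷ I ∷ I ∷ I ∷ O ∷ O ∷ I ∷ O ∷ I ∷ I ∷ I ∷ O ∷ I ∷ O ∷ []) ∷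
  (O ∷ I ∷ O ∷ I ∷ I ∷ I ∷ O ∷ I ∷ O ∷ I ∷ I ∷ I ∷ O ∷ I ∷ O ∷ []) ∷
  (O ∷ I ∷ I ∷ O ∷ I ∷ O ∷ I ∷ I ∷ O ∷ I ∷ I ∷ I ∷ O ∷ I ∷ O ∷ []) ∷
  (O ∷ I ∷ O ∷ O ∷ I ∷ I ∷ I ∷ I ∷ O ∷ I ∷ I ∷ I ∷ O ∷ I ∷ O ∷ []) ∷
  (I ∷ O ∷ I ∷ O ∷ I ∷ O ∷ I ∷ O ∷ I ∷ I ∷ I ∷ I ∷ O ∷ I ∷ O ∷ []) ∷
  (I ∷ O ∷ I ∷ O ∷ O ∷ I ∷ I ∷ O ∷ I ∷ I ∷ I ∷ I ∷ O ∷ I ∷ O ∷ []) ∷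
  (O ∷ I ∷ O ∷ I ∷ O ∷ I ∷ O ∷ I ∷ I ∷ I ∷ I ∷ I ∷ O ∷ I ∷ O ∷ []) ∷
  (O ∷ O ∷ I ∷ O ∷ I ∷ O ∷ I ∷ I ∷ I ∷ I ∷ I ∷ I ∷ O ∷ I ∷ O ∷ []) ∷
  (I ∷ I ∷ I ∷ I ∷ O ∷ I ∷ I ∷ I ∷ O ∷ O ∷ O ∷ O ∷ I ∷ I ∷ O ∷ []) ∷
  (I ∷ I ∷ I ∷ O ∷ I ∷ O ∷ I ∷ I ∷ I ∷ O ∷ O ∷ O ∷ I ∷ I ∷ O ∷ []) ∷
  (I ∷ I ∷ I ∷ O ∷ O ∷ I ∷ I ∷ I ∷ I ∷ O ∷ O ∷ O ∷ I ∷ I ∷ O ∷ []) ∷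
  (O ∷ I ∷ I ∷ I ∷ I ∷ I ∷ I ∷ O ∷ O ∷ I ∷ O ∷ O ∷ I ∷ I ∷ O ∷ []) ∷
  (O ∷ I ∷ I ∷ I ∷ O ∷ I ∷ I ∷ I ∷ O ∷ I ∷ O ∷ O ∷ I ∷ I ∷ O ∷ []) ∷
  (I ∷ O ∷ I ∷ I ∷ I ∷ I ∷ O ∷ O ∷ I ∷ I ∷ O ∷ O ∷ I ∷ I ∷ O ∷ []) ∷
  (O ∷ O ∷ I ∷ I ∷ I ∷ I ∷ I ∷ O ∷ I ∷ I ∷ O ∷ O ∷ I ∷ I ∷ O ∷ []) ∷
  (I ∷ I ∷ O ∷ I ∷ I ∷ O ∷ O ∷ I ∷ I ∷ I ∷ O ∷ O ∷ I ∷ I ∷ O ∷ []) ∷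
  (I ∷ O ∷ O ∷ I ∷ I ∷ I ∷ O ∷ I ∷ I ∷ I ∷ O ∷ O ∷ I ∷ I ∷ O ∷ []) ∷
  (I ∷ I ∷ O ∷ O ∷ I ∷ O ∷ I ∷ I ∷ I ∷ I ∷ O ∷ O ∷ I ∷ I ∷ O ∷ []) ∷
  (I ∷ I ∷ I ∷ I ∷ O ∷ I ∷ O ∷ I ∷ O ∷ O ∷ I ∷ O ∷ I ∷ I ∷ O ∷ []) ∷
  (I ∷ O ∷ I ∷ I ∷ I ∷ I ∷ O ∷ O ∷ I ∷ O ∷ I ∷ O ∷ I ∷ I ∷ O ∷ []) ∷
  (I ∷ I ∷ I ∷ O ∷ I ∷ O ∷ I ∷ O ∷ I ∷ O ∷ I ∷ O ∷ I ∷ I ∷ O ∷ []) ∷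
  (I ∷ O ∷ I ∷ O ∷ I ∷ I ∷ I ∷ O ∷ I ∷ O ∷ I ∷ O ∷ I ∷ I ∷ O ∷ []) ∷
  (I ∷ O ∷ I ∷ I ∷ O ∷ I ∷ O ∷ I ∷ I ∷ O ∷ I ∷ O ∷ I ∷ I ∷ O ∷ []) ∷
  (I ∷ O ∷ I ∷ O ∷ O ∷ I ∷ I ∷ I ∷ I ∷ O ∷ I ∷ O ∷ I ∷ I ∷ O ∷ []) ∷
  (O ∷ I ∷ I ∷ I ∷ I ∷ O ∷ I ∷ O ∷ O ∷ I ∷ I ∷ O ∷ I ∷ I ∷ O ∷ []) ∷
  (I ∷ I ∷ O ∷ I ∷ I ∷ O ∷ O ∷ I ∷ O ∷ I ∷ I ∷ O ∷ I ∷ I ∷ O ∷ []) ∷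
  (I ∷ I ∷ O ∷ I ∷ O ∷ I ∷ O ∷ I ∷ O ∷ I ∷ I ∷ O ∷ I ∷ I ∷ O ∷ []) ∷
  (O ∷ I ∷ O ∷ I ∷ I ∷ O ∷ I ∷ I ∷ O ∷ I ∷ I ∷ O ∷ I ∷ I ∷ O ∷ []) ∷
  (O ∷ I ∷ O ∷ I ∷ O ∷ I ∷ I ∷ I ∷ O ∷ I ∷ I ∷ O ∷ I ∷ I ∷ O ∷ []) ∷
  (O ∷ I ∷ I ∷ O ∷ I ∷ O ∷ I ∷ O ∷ I ∷ I ∷ I ∷ O ∷ I ∷ I ∷ O ∷ []) ∷
  (O ∷ O ∷ I ∷ O ∷ I ∷ I ∷ I ∷ O ∷ I ∷ I ∷ I ∷ O ∷ I ∷ I ∷ O ∷ []) ∷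
  (I ∷ O ∷ O ∷ I ∷ O ∷ I ∷ O ∷ I ∷ I ∷ I ∷ I ∷ O ∷ I ∷ I ∷ O ∷ []) ∷
  (O ∷ I ∷ O ∷ O ∷ I ∷ O ∷ I ∷ I ∷ I ∷ I ∷ I ∷ O ∷ I ∷ I ∷ O ∷ []) ∷
  (I ∷ I ∷ I ∷ I ∷ O ∷ I ∷ I ∷ O ∷ O ∷ O ∷ O ∷ I ∷ I ∷ I ∷ O ∷ []) ∷
  (I ∷ I ∷ I ∷ O ∷ I ∷ O ∷ I ∷ I ∷ O ∷ O ∷ O ∷ I ∷ I ∷ I ∷ O ∷ []) ∷
  (I ∷ I ∷ I ∷ O ∷ O ∷ I ∷ I ∷ I ∷ O ∷ O ∷ O ∷ I ∷ I ∷ I ∷ O ∷ []) ∷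
  (I ∷ I ∷ O ∷ I ∷ I ∷ O ∷ O ∷ I ∷ I ∷ O ∷ O ∷ I ∷ I ∷ I ∷ O ∷ []) ∷
  (I ∷ I ∷ O ∷ O ∷ I ∷ O ∷ I ∷ I ∷ I ∷ O ∷ O ∷ I ∷ I ∷ I ∷ O ∷ []) ∷
  (I ∷ I ∷ O ∷ O ∷ O ∷ I ∷ I ∷ I ∷ I ∷ O ∷ O ∷ I ∷ I ∷ I ∷ O ∷ []) ∷
  (O ∷ I ∷ I ∷ I ∷ I ∷ I ∷ O ∷ O ∷ O ∷ I ∷ O ∷ I ∷ I ∷ I ∷ O ∷ []) ∷
  (O ∷ I ∷ I ∷ I ∷ O ∷ I ∷ I ∷ O ∷ O ∷ I ∷ O ∷ I ∷ I ∷ I ∷ O ∷ []) ∷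
  (O ∷ I ∷ I ∷ O ∷ O ∷ I ∷ I ∷ I ∷ O ∷ I ∷ O ∷ I ∷ I ∷ I ∷ O ∷ []) ∷
  (I ∷ O ∷ I ∷ I ∷ I ∷ O ∷ O ∷ O ∷ I ∷ I ∷ O ∷ I ∷ I ∷ I ∷ O ∷ []) ∷
  (O ∷ O ∷ I ∷ I ∷ I ∷ I ∷ O ∷ O ∷ I ∷ I ∷ O ∷ I ∷ I ∷ I ∷ O ∷ []) ∷
  (O ∷ O ∷ I ∷ I ∷ O ∷ I ∷ I ∷ O ∷ I ∷ I ∷ O ∷ I ∷ I ∷ I ∷ O ∷ []) ∷
  (I ∷ O ∷ O ∷ I ∷ I ∷ O ∷ O ∷ I ∷ I ∷ I ∷ O ∷ I ∷ I ∷ I ∷ O ∷ []) ∷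
  (O ∷ O ∷ O ∷ I ∷ I ∷ I ∷ O ∷ I ∷ I ∷ I ∷ O ∷ I ∷ I ∷ I ∷ O ∷ []) ∷
  (I ∷ O ∷ O ∷ O ∷ I ∷ O ∷ I ∷ I ∷ I ∷ I ∷ O ∷ I ∷ I ∷ I ∷ O ∷ []) ∷
  (I ∷ I ∷ I ∷ I ∷ O ∷ I ∷ O ∷ O ∷ O ∷ O ∷ I ∷ I ∷ I ∷ I ∷ O ∷ []) ∷
  (I ∷ I ∷ I ∷ O ∷ I ∷ O ∷ I ∷ O ∷ O ∷ O ∷ I ∷ I ∷ I ∷ I ∷ O ∷ []) ∷
  (I ∷ I ∷ I ∷ O ∷ O ∷ I ∷ I ∷ O ∷ O ∷ O ∷ I ∷ I ∷ I ∷ I ∷ O ∷ []) ∷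
  (I ∷ I ∷ O ∷ I ∷ I ∷ O ∷ O ∷ I ∷ O ∷ O ∷ I ∷ I ∷ I ∷ I ∷ O ∷ []) ∷
  (I ∷ I ∷ O ∷ I ∷ O ∷ I ∷ O ∷ I ∷ O ∷ O ∷ I ∷ I ∷ I ∷ I ∷ O ∷ []) ∷
  (I ∷ I ∷ O ∷ O ∷ I ∷ O ∷ I ∷ I ∷ O ∷ O ∷ I ∷ I ∷ I ∷ I ∷ O ∷ []) ∷
  (I ∷ I ∷ O ∷ O ∷ O ∷ I ∷ I ∷ I ∷ O ∷ O ∷ I ∷ I ∷ I ∷ I ∷ O ∷ []) ∷
  (I ∷ O ∷ I ∷ I ∷ I ∷ O ∷ O ∷ O ∷ I ∷ O ∷ I ∷ I ∷ I ∷ I ∷ O ∷ []) ∷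
  (I ∷ O ∷ I ∷ I ∷ O ∷ I ∷ O ∷ O ∷ I ∷ O ∷ I ∷ I ∷ I ∷ I ∷ O ∷ []) ∷
  (I ∷ O ∷ I ∷ O ∷ I ∷ O ∷ I ∷ O ∷ I ∷ O ∷ I ∷ I ∷ I ∷ I ∷ O ∷ []) ∷
  (I ∷ O ∷ I ∷ O ∷ O ∷ I ∷ I ∷ O ∷ I ∷ O ∷ I ∷ I ∷ I ∷ I ∷ O ∷ []) ∷
  (I ∷ O ∷ O ∷ I ∷ I ∷ O ∷ O ∷ I ∷ I ∷ O ∷ I ∷ I ∷ I ∷ I ∷ O ∷ []) ∷
  (I ∷ O ∷ O ∷ I ∷ O ∷ I ∷ O ∷ I ∷ I ∷ O ∷ I ∷ I ∷ I ∷ I ∷ O ∷ []) ∷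
  (I ∷ O ∷ O ∷ O ∷ I ∷ O ∷ I ∷ I ∷ I ∷ O ∷ I ∷ I ∷ I ∷ I ∷ O ∷ []) ∷
  (I ∷ O ∷ O ∷ O ∷ O ∷ I ∷ I ∷ I ∷ I ∷ O ∷ I ∷ I ∷ I ∷ I ∷ O ∷ []) ∷
  (O ∷ I ∷ I ∷ I ∷ I ∷ O ∷ O ∷ O ∷ O ∷ I ∷ I ∷ I ∷ I ∷ I ∷ O ∷ []) ∷
  (O ∷ I ∷ I ∷ I ∷ O ∷ I ∷ O ∷ O ∷ O ∷ I ∷ I ∷ I ∷ I ∷ I ∷ O ∷ []) ∷
  (O ∷ I ∷ I ∷ O ∷ I ∷ O ∷ I ∷ O ∷ O ∷ I ∷ I ∷ I ∷ I ∷ I ∷ O ∷ []) ∷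
  (O ∷ I ∷ I ∷ O ∷ O ∷ I ∷ I ∷ O ∷ O ∷ I ∷ I ∷ I ∷ I ∷ I ∷ O ∷ []) ∷
  (O ∷ I ∷ O ∷ I ∷ I ∷ O ∷ O ∷ I ∷ O ∷ I ∷ I ∷ I ∷ I ∷ I ∷ O ∷ []) ∷
  (O ∷ I ∷ O ∷ I ∷ O ∷ I ∷ O ∷ I ∷ O ∷ I ∷ I ∷ I ∷ I ∷ I ∷ O ∷ []) ∷
  (O ∷ I ∷ O ∷ O ∷ I ∷ O ∷ I ∷ I ∷ O ∷ I ∷ I ∷ I ∷ I ∷ I ∷ O ∷ []) ∷
  (O ∷ I ∷ O ∷ O ∷ O ∷ I ∷ I ∷ I ∷ O ∷ I ∷ I ∷ I ∷ I ∷ I ∷ O ∷ []) ∷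
  (O ∷ O ∷ I ∷ I ∷ I ∷ O ∷ O ∷ O ∷ I ∷ I ∷ I ∷ I ∷ I ∷ I ∷ O ∷ []) ∷
  (O ∷ O ∷ I ∷ I ∷ O ∷ I ∷ O ∷ O ∷ I ∷ I ∷ I ∷ I ∷ I ∷ I ∷ O ∷ []) ∷
  (O ∷ O ∷ I ∷ O ∷ I ∷ O ∷ I ∷ O ∷ I ∷ I ∷ I ∷ I ∷ I ∷ I ∷ O ∷ []) ∷
  (O ∷ O ∷ I ∷ O ∷ O ∷ I ∷ I ∷ O ∷ I ∷ I ∷ I ∷ I ∷ I ∷ I ∷ O ∷ []) ∷
  (O ∷ O ∷ O ∷ I ∷ I ∷ O ∷ O ∷ I ∷ I ∷ I ∷ I ∷ I ∷ I ∷ I ∷ O ∷ []) ∷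
  (O ∷ O ∷ O ∷ I ∷ O ∷ I ∷ O ∷ I ∷ I ∷ I ∷ I ∷ I ∷ I ∷ I ∷ O ∷ []) ∷
  (O ∷ O ∷ O ∷ O ∷ I ∷ O ∷ I ∷ I ∷ I ∷ I ∷ I ∷ I ∷ I ∷ I ∷ O ∷ []) ∷
  (O ∷ I ∷ I ∷ I ∷ I ∷ I ∷ I ∷ I ∷ I ∷ O ∷ O ∷ O ∷ O ∷ O ∷ I ∷ []) ∷
  (I ∷ O ∷ I ∷ I ∷ I ∷ I ∷ I ∷ I ∷ O ∷ I ∷ O ∷ O ∷ O ∷ O ∷ I ∷ []) ∷
  (I ∷ I ∷ O ∷ I ∷ I ∷ I ∷ I ∷ O ∷ I ∷ I ∷ O ∷ O ∷ O ∷ O ∷ I ∷ []) ∷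
  (I ∷ I ∷ I ∷ O ∷ I ∷ I ∷ O ∷ I ∷ I ∷ I ∷ O ∷ O ∷ O ∷ O ∷ I ∷ []) ∷
  (I ∷ I ∷ I ∷ I ∷ O ∷ O ∷ I ∷ I ∷ I ∷ I ∷ O ∷ O ∷ O ∷ O ∷ I ∷ []) ∷
  (I ∷ O ∷ I ∷ I ∷ I ∷ I ∷ I ∷ I ∷ O ∷ O ∷ I ∷ O ∷ O ∷ O ∷ I ∷ []) ∷
  (O ∷ I ∷ I ∷ I ∷ I ∷ O ∷ I ∷ I ∷ I ∷ O ∷ I ∷ O ∷ O ∷ O ∷ I ∷ []) ∷
  (O ∷ O ∷ I ∷ I ∷ I ∷ I ∷ I ∷ I ∷ I ∷ O ∷ I ∷ O ∷ O ∷ O ∷ I ∷ []) ∷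
  (I ∷ I ∷ O ∷ I ∷ I ∷ I ∷ I ∷ O ∷ O ∷ I ∷ I ∷ O ∷ O ∷ O ∷ I ∷ []) ∷
  (I ∷ O ∷ O ∷ I ∷ I ∷ I ∷ I ∷ I ∷ O ∷ I ∷ I ∷ O ∷ O ∷ O ∷ I ∷ []) ∷
  (I ∷ I ∷ I ∷ O ∷ I ∷ I ∷ O ∷ O ∷ I ∷ I ∷ I ∷ O ∷ O ∷ O ∷ I ∷ []) ∷
  (I ∷ I ∷ O ∷ O ∷ I ∷ I ∷ I ∷ O ∷ I ∷ I ∷ I ∷ O ∷ O ∷ O ∷ I ∷ []) ∷
  (I ∷ I ∷ I ∷ I ∷ O ∷ O ∷ O ∷ I ∷ I ∷ I ∷ I ∷ O ∷ O ∷ O ∷ I ∷ []) ∷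
  (I ∷ I ∷ I ∷ O ∷ O ∷ I ∷ O ∷ I ∷ I ∷ I ∷ I ∷ O ∷ O ∷ O ∷ I ∷ []) ∷
  (O ∷ I ∷ I ∷ I ∷ O ∷ O ∷ I ∷ I ∷ I ∷ I ∷ I ∷ O ∷ O ∷ O ∷ I ∷ []) ∷
  (I ∷ I ∷ O ∷ I ∷ I ∷ I ∷ I ∷ O ∷ I ∷ O ∷ O ∷ I ∷ O ∷ O ∷ I ∷ []) ∷
  (O ∷ I ∷ I ∷ I ∷ I ∷ I ∷ O ∷ I ∷ I ∷ O ∷ O ∷ I ∷ O ∷ O ∷ I ∷ []) ∷
  (O ∷ I ∷ O ∷ I ∷ I ∷ I ∷ I ∷ I ∷ I ∷ O ∷ O ∷ I ∷ O ∷ O ∷ I ∷ []) ∷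
  (I ∷ I ∷ I ∷ O ∷ I ∷ I ∷ O ∷ I ∷ O ∷ I ∷ O ∷ I ∷ O ∷ O ∷ I ∷ []) ∷
  (I ∷ O ∷ I ∷ I ∷ I ∷ O ∷ I ∷ I ∷ O ∷ I ∷ O ∷ I ∷ O ∷ O ∷ I ∷ []) ∷
  (I ∷ O ∷ I ∷ O ∷ I ∷ I ∷ I ∷ I ∷ O ∷ I ∷ O ∷ I ∷ O ∷ O ∷ I ∷ []) ∷
  (I ∷ I ∷ I ∷ I ∷ O ∷ O ∷ I ∷ O ∷ I ∷ I ∷ O ∷ I ∷ O ∷ O ∷ I ∷ []) ∷
  (I ∷ I ∷ O ∷ I ∷ O ∷ I ∷ I ∷ O ∷ I ∷ I ∷ O ∷ I ∷ O ∷ O ∷ I ∷ []) ∷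
  (O ∷ I ∷ I ∷ O ∷ I ∷ I ∷ O ∷ I ∷ I ∷ I ∷ O ∷ I ∷ O ∷ O ∷ I ∷ []) ∷
  (I ∷ O ∷ I ∷ I ∷ O ∷ O ∷ I ∷ I ∷ I ∷ I ∷ O ∷ I ∷ O ∷ O ∷ I ∷ []) ∷
  (I ∷ I ∷ O ∷ I ∷ I ∷ I ∷ I ∷ O ∷ O ∷ O ∷ I ∷ I ∷ O ∷ O ∷ I ∷ []) ∷
  (I ∷ O ∷ I ∷ I ∷ I ∷ O ∷ I ∷ I ∷ O ∷ O ∷ I ∷ I ∷ O ∷ O ∷ I ∷ []) ∷
  (I ∷ O ∷ O ∷ I ∷ I ∷ I ∷ I ∷ I ∷ O ∷ O ∷ I ∷ I ∷ O ∷ O ∷ I ∷ []) ∷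
  (O ∷ I ∷ I ∷ I ∷ I ∷ O ∷ O ∷ I ∷ I ∷ O ∷ I ∷ I ∷ O ∷ O ∷ I ∷ []) ∷
  (O ∷ O ∷ I ∷ I ∷ I ∷ O ∷ I ∷ I ∷ I ∷ O ∷ I ∷ I ∷ O ∷ O ∷ I ∷ []) ∷
  (O ∷ O ∷ O ∷ I ∷ I ∷ I ∷ I ∷ I ∷ I ∷ O ∷ I ∷ I ∷ O ∷ O ∷ I ∷ []) ∷
  (I ∷ I ∷ I ∷ O ∷ I ∷ I ∷ O ∷ O ∷ O ∷ I ∷ I ∷ I ∷ O ∷ O ∷ I ∷ []) ∷
  (I ∷ I ∷ O ∷ O ∷ I ∷ I ∷ I ∷ O ∷ O ∷ I ∷ I ∷ I ∷ O ∷ O ∷ I ∷ []) ∷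
  (I ∷ O ∷ O ∷ O ∷ I ∷ I ∷ I ∷ I ∷ O ∷ I ∷ I ∷ I ∷ O ∷ O ∷ I ∷ []) ∷
  (I ∷ I ∷ I ∷ I ∷ O ∷ O ∷ O ∷ O ∷ I ∷ I ∷ I ∷ I ∷ O ∷ O ∷ I ∷ []) ∷
  (I ∷ I ∷ I ∷ O ∷ O ∷ I ∷ O ∷ O ∷ I ∷ I ∷ I ∷ I ∷ O ∷ O ∷ I ∷ []) ∷
  (I ∷ I ∷ O ∷ O ∷ O ∷ I ∷ I ∷ O ∷ I ∷ I ∷ I ∷ I ∷ O ∷ O ∷ I ∷ []) ∷
  (O ∷ I ∷ I ∷ I ∷ O ∷ O ∷ O ∷ I ∷ I ∷ I ∷ I ∷ I ∷ O ∷ O ∷ I ∷ []) ∷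
  (O ∷ I ∷ I ∷ O ∷ O ∷ I ∷ O ∷ I ∷ I ∷ I ∷ I ∷ I ∷ O ∷ O ∷ I ∷ []) ∷
  (O ∷ O ∷ I ∷ I ∷ O ∷ O ∷ I ∷ I ∷ I ∷ I ∷ I ∷ I ∷ O ∷ O ∷ I ∷ []) ∷
  (O ∷ I ∷ I ∷ I ∷ I ∷ I ∷ I ∷ O ∷ I ∷ O ∷ O ∷ O ∷ I ∷ O ∷ I ∷ []) ∷
  (I ∷ I ∷ I ∷ O ∷ I ∷ I ∷ O ∷ I ∷ I ∷ O ∷ O ∷ O ∷ I ∷ O ∷ I ∷ []) ∷
  (O ∷ I ∷ I ∷ O ∷ I ∷ I ∷ I ∷ I ∷ I ∷ O ∷ O ∷ O ∷ I ∷ O ∷ I ∷ []) ∷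
  (I ∷ O ∷ I ∷ I ∷ I ∷ I ∷ O ∷ I ∷ O ∷ I ∷ O ∷ O ∷ I ∷ O ∷ I ∷ []) ∷
  (I ∷ I ∷ I ∷ I ∷ O ∷ O ∷ I ∷ I ∷ O ∷ I ∷ O ∷ O ∷ I ∷ O ∷ I ∷ []) ∷
  (I ∷ O ∷ I ∷ I ∷ O ∷ I ∷ I ∷ I ∷ O ∷ I ∷ O ∷ O ∷ I ∷ O ∷ I ∷ []) ∷
  (I ∷ I ∷ O ∷ I ∷ I ∷ O ∷ I ∷ O ∷ I ∷ I ∷ O ∷ O ∷ I ∷ O ∷ I ∷ []) ∷
  (O ∷ I ∷ O ∷ I ∷ I ∷ I ∷ I ∷ O ∷ I ∷ I ∷ O ∷ O ∷ I ∷ O ∷ I ∷ []) ∷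
  (I ∷ O ∷ I ∷ O ∷ I ∷ I ∷ O ∷ I ∷ I ∷ I ∷ O ∷ O ∷ I ∷ O ∷ I ∷ []) ∷
  (I ∷ I ∷ O ∷ I ∷ O ∷ O ∷ I ∷ I ∷ I ∷ I ∷ O ∷ O ∷ I ∷ O ∷ I ∷ []) ∷
  (I ∷ O ∷ I ∷ I ∷ I ∷ I ∷ O ∷ I ∷ O ∷ O ∷ I ∷ O ∷ I ∷ O ∷ I ∷ []) ∷
  (I ∷ I ∷ I ∷ O ∷ I ∷ I ∷ O ∷ O ∷ I ∷ O ∷ I ∷ O ∷ I ∷ O ∷ I ∷ []) ∷
  (O ∷ I ∷ I ∷ I ∷ I ∷ O ∷ I ∷ O ∷ I ∷ O ∷ I ∷ O ∷ I ∷ O ∷ I ∷ []) ∷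
  (O ∷ I ∷ I ∷ O ∷ I ∷ I ∷ I ∷ O ∷ I ∷ O ∷ I ∷ O ∷ I ∷ O ∷ I ∷ []) ∷
  (I ∷ O ∷ I ∷ O ∷ I ∷ I ∷ O ∷ I ∷ I ∷ O ∷ I ∷ O ∷ I ∷ O ∷ I ∷ []) ∷
  (O ∷ O ∷ I ∷ O ∷ I ∷ I ∷ I ∷ I ∷ I ∷ O ∷ I ∷ O ∷ I ∷ O ∷ I ∷ []) ∷
  (I ∷ I ∷ O ∷ I ∷ I ∷ O ∷ I ∷ O ∷ O ∷ I ∷ I ∷ O ∷ I ∷ O ∷ I ∷ []) ∷
  (I ∷ I ∷ I ∷ I ∷ O ∷ O ∷ O ∷ I ∷ O ∷ I ∷ I ∷ O ∷ I ∷ O ∷ I ∷ []) ∷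
  (I ∷ O ∷ I ∷ I ∷ O ∷ I ∷ O ∷ I ∷ O ∷ I ∷ I ∷ O ∷ I ∷ O ∷ I ∷ []) ∷
  (I ∷ I ∷ O ∷ I ∷ O ∷ O ∷ I ∷ I ∷ O ∷ I ∷ I ∷ O ∷ I ∷ O ∷ I ∷ []) ∷
  (I ∷ O ∷ O ∷ I ∷ O ∷ I ∷ I ∷ I ∷ O ∷ I ∷ I ∷ O ∷ I ∷ O ∷ I ∷ []) ∷
  (O ∷ I ∷ O ∷ I ∷ I ∷ O ∷ I ∷ O ∷ I ∷ I ∷ I ∷ O ∷ I ∷ O ∷ I ∷ []) ∷
  (O ∷ I ∷ O ∷ O ∷ I ∷ I ∷ I ∷ O ∷ I ∷ I ∷ I ∷ O ∷ I ∷ O ∷ I ∷ []) ∷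
  (I ∷ O ∷ I ∷ O ∷ O ∷ I ∷ O ∷ I ∷ I ∷ I ∷ I ∷ O ∷ I ∷ O ∷ I ∷ []) ∷
  (O ∷ I ∷ O ∷ I ∷ O ∷ O ∷ I ∷ I ∷ I ∷ I ∷ I ∷ O ∷ I ∷ O ∷ I ∷ []) ∷
  (I ∷ I ∷ I ∷ O ∷ I ∷ I ∷ O ∷ I ∷ O ∷ O ∷ O ∷ I ∷ I ∷ O ∷ I ∷ []) ∷
  (O ∷ I ∷ I ∷ I ∷ I ∷ I ∷ O ∷ O ∷ I ∷ O ∷ O ∷ I ∷ I ∷ O ∷ I ∷ []) ∷
  (I ∷ I ∷ O ∷ I ∷ I ∷ O ∷ I ∷ O ∷ I ∷ O ∷ O ∷ I ∷ I ∷ O ∷ I ∷ []) ∷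
  (O ∷ I ∷ O ∷ I ∷ I ∷ I ∷ I ∷ O ∷ I ∷ O ∷ O ∷ I ∷ I ∷ O ∷ I ∷ []) ∷
  (O ∷ I ∷ I ∷ O ∷ I ∷ I ∷ O ∷ I ∷ I ∷ O ∷ O ∷ I ∷ I ∷ O ∷ I ∷ []) ∷
  (O ∷ I ∷ O ∷ O ∷ I ∷ I ∷ I ∷ I ∷ I ∷ O ∷ O ∷ I ∷ I ∷ O ∷ I ∷ []) ∷
  (I ∷ I ∷ I ∷ I ∷ O ∷ O ∷ I ∷ O ∷ O ∷ I ∷ O ∷ I ∷ I ∷ O ∷ I ∷ []) ∷
  (I ∷ O ∷ I ∷ I ∷ I ∷ O ∷ O ∷ I ∷ O ∷ I ∷ O ∷ I ∷ I ∷ O ∷ I ∷ []) ∷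
  (I ∷ O ∷ I ∷ O ∷ I ∷ I ∷ O ∷ I ∷ O ∷ I ∷ O ∷ I ∷ I ∷ O ∷ I ∷ []) ∷
  (I ∷ O ∷ I ∷ I ∷ O ∷ O ∷ I ∷ I ∷ O ∷ I ∷ O ∷ I ∷ I ∷ O ∷ I ∷ []) ∷
  (I ∷ O ∷ I ∷ O ∷ O ∷ I ∷ I ∷ I ∷ O ∷ I ∷ O ∷ I ∷ I ∷ O ∷ I ∷ []) ∷
  (I ∷ I ∷ O ∷ I ∷ O ∷ O ∷ I ∷ O ∷ I ∷ I ∷ O ∷ I ∷ I ∷ O ∷ I ∷ []) ∷
  (O ∷ I ∷ O ∷ I ∷ O ∷ I ∷ I ∷ O ∷ I ∷ I ∷ O ∷ I ∷ I ∷ O ∷ I ∷ []) ∷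
  (O ∷ O ∷ I ∷ O ∷ I ∷ I ∷ O ∷ I ∷ I ∷ I ∷ O ∷ I ∷ I ∷ O ∷ I ∷ []) ∷
  (I ∷ O ∷ O ∷ I ∷ O ∷ O ∷ I ∷ I ∷ I ∷ I ∷ O ∷ I ∷ I ∷ O ∷ I ∷ []) ∷
  (I ∷ I ∷ I ∷ O ∷ I ∷ I ∷ O ∷ O ∷ O ∷ O ∷ I ∷ I ∷ I ∷ O ∷ I ∷ []) ∷
  (I ∷ I ∷ O ∷ I ∷ I ∷ O ∷ I ∷ O ∷ O ∷ O ∷ I ∷ I ∷ I ∷ O ∷ I ∷ []) ∷
  (I ∷ I ∷ O ∷ O ∷ I ∷ I ∷ I ∷ O ∷ O ∷ O ∷ I ∷ I ∷ I ∷ O ∷ I ∷ []) ∷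
  (I ∷ O ∷ I ∷ I ∷ I ∷ O ∷ O ∷ I ∷ O ∷ O ∷ I ∷ I ∷ I ∷ O ∷ I ∷ []) ∷
  (I ∷ O ∷ I ∷ O ∷ I ∷ I ∷ O ∷ I ∷ O ∷ O ∷ I ∷ I ∷ I ∷ O ∷ I ∷ []) ∷
  (I ∷ O ∷ O ∷ I ∷ I ∷ O ∷ I ∷ I ∷ O ∷ O ∷ I ∷ I ∷ I ∷ O ∷ I ∷ []) ∷
  (I ∷ O ∷ O ∷ O ∷ I ∷ I ∷ I ∷ I ∷ O ∷ O ∷ I ∷ I ∷ I ∷ O ∷ I ∷ []) ∷
  (O ∷ I ∷ I ∷ I ∷ I ∷ O ∷ O ∷ O ∷ I ∷ O ∷ I ∷ I ∷ I ∷ O ∷ I ∷ []) ∷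
  (O ∷ I ∷ I ∷ O ∷ I ∷ I ∷ O ∷ O ∷ I ∷ O ∷ I ∷ I ∷ I ∷ O ∷ I ∷ []) ∷
  (O ∷ I ∷ O ∷ I ∷ I ∷ O ∷ I ∷ O ∷ I ∷ O ∷ I ∷ I ∷ I ∷ O ∷ I ∷ []) ∷
  (O ∷ I ∷ O ∷ O ∷ I ∷ I ∷ I ∷ O ∷ I ∷ O ∷ I ∷ I ∷ I ∷ O ∷ I ∷ []) ∷
  (O ∷ O ∷ I ∷ I ∷ I ∷ O ∷ O ∷ I ∷ I ∷ O ∷ I ∷ I ∷ I ∷ O ∷ I ∷ []) ∷
  (O ∷ O ∷ I ∷ O ∷ I ∷ I ∷ O ∷ I ∷ I ∷ O ∷ I ∷ I ∷ I ∷ O ∷ I ∷ []) ∷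
  (O ∷ O ∷ O ∷ I ∷ I ∷ O ∷ I ∷ I ∷ I ∷ O ∷ I ∷ I ∷ I ∷ O ∷ I ∷ []) ∷
  (O ∷ O ∷ O ∷ O ∷ I ∷ I ∷ I ∷ I ∷ I ∷ O ∷ I ∷ I ∷ I ∷ O ∷ I ∷ []) ∷
  (I ∷ I ∷ I ∷ I ∷ O ∷ O ∷ O ∷ O ∷ O ∷ I ∷ I ∷ I ∷ I ∷ O ∷ I ∷ []) ∷
  (I ∷ I ∷ I ∷ O ∷ O ∷ I ∷ O ∷ O ∷ O ∷ I ∷ I ∷ I ∷ I ∷ O ∷ I ∷ []) ∷
  (I ∷ I ∷ O ∷ I ∷ O ∷ O ∷ I ∷ O ∷ O ∷ I ∷ I ∷ I ∷ I ∷ O ∷ I ∷ []) ∷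
  (I ∷ I ∷ O ∷ O ∷ O ∷ I ∷ I ∷ O ∷ O ∷ I ∷ I ∷ I ∷ I ∷ O ∷ I ∷ []) ∷
  (I ∷ O ∷ I ∷ I ∷ O ∷ O ∷ O ∷ I ∷ O ∷ I ∷ I ∷ I ∷ I ∷ O ∷ I ∷ []) ∷
  (I ∷ O ∷ I ∷ O ∷ O ∷ I ∷ O ∷ I ∷ O ∷ I ∷ I ∷ I ∷ I ∷ O ∷ I ∷ []) ∷
  (I ∷ O ∷ O ∷ I ∷ O ∷ O ∷ I ∷ I ∷ O ∷ I ∷ I ∷ I ∷ I ∷ O ∷ I ∷ []) ∷
  (I ∷ O ∷ O ∷ O ∷ O ∷ I ∷ I ∷ I ∷ O ∷ I ∷ I ∷ I ∷ I ∷ O ∷ I ∷ []) ∷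
  (O ∷ I ∷ I ∷ I ∷ O ∷ O ∷ O ∷ O ∷ I ∷ I ∷ I ∷ I ∷ I ∷ O ∷ I ∷ []) ∷
  (O ∷ I ∷ I ∷ O ∷ O ∷ I ∷ O ∷ O ∷ I ∷ I ∷ I ∷ I ∷ I ∷ O ∷ I ∷ []) ∷
  (O ∷ I ∷ O ∷ I ∷ O ∷ O ∷ I ∷ O ∷ I ∷ I ∷ I ∷ I ∷ I ∷ O ∷ I ∷ []) ∷
  (O ∷ I ∷ O ∷ O ∷ O ∷ I ∷ I ∷ O ∷ I ∷ I ∷ I ∷ I ∷ I ∷ O ∷ I ∷ []) ∷
  (O ∷ O ∷ I ∷ I ∷ O ∷ O ∷ O ∷ I ∷ I ∷ I ∷ I ∷ I ∷ I ∷ O ∷ I ∷ []) ∷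
  (O ∷ O ∷ I ∷ O ∷ O ∷ I ∷ O ∷ I ∷ I ∷ I ∷ I ∷ I ∷ I ∷ O ∷ I ∷ []) ∷
  (O ∷ O ∷ O ∷ I ∷ O ∷ O ∷ I ∷ I ∷ I ∷ I ∷ I ∷ I ∷ I ∷ O ∷ I ∷ []) ∷
  (O ∷ I ∷ I ∷ I ∷ I ∷ I ∷ I ∷ I ∷ O ∷ O ∷ O ∷ O ∷ O ∷ I ∷ I ∷ []) ∷
  (I ∷ I ∷ I ∷ I ∷ O ∷ O ∷ I ∷ I ∷ I ∷ O ∷ O ∷ O ∷ O ∷ I ∷ I ∷ []) ∷
  (O ∷ I ∷ I ∷ I ∷ O ∷ I ∷ I ∷ I ∷ I ∷ O ∷ O ∷ O ∷ O ∷ I ∷ I ∷ []) ∷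
  (I ∷ O ∷ I ∷ I ∷ I ∷ I ∷ I ∷ O ∷ O ∷ I ∷ O ∷ O ∷ O ∷ I ∷ I ∷ []) ∷
  (O ∷ O ∷ I ∷ I ∷ I ∷ I ∷ I ∷ I ∷ O ∷ I ∷ O ∷ O ∷ O ∷ I ∷ I ∷ []) ∷
  (I ∷ I ∷ O ∷ I ∷ I ∷ I ∷ O ∷ O ∷ I ∷ I ∷ O ∷ O ∷ O ∷ I ∷ I ∷ []) ∷
  (I ∷ O ∷ O ∷ I ∷ I ∷ I ∷ I ∷ O ∷ I ∷ I ∷ O ∷ O ∷ O ∷ I ∷ I ∷ []) ∷
  (I ∷ I ∷ I ∷ O ∷ I ∷ O ∷ O ∷ I ∷ I ∷ I ∷ O ∷ O ∷ O ∷ I ∷ I ∷ []) ∷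
  (I ∷ I ∷ O ∷ O ∷ I ∷ I ∷ O ∷ I ∷ I ∷ I ∷ O ∷ O ∷ O ∷ I ∷ I ∷ []) ∷
  (I ∷ I ∷ I ∷ O ∷ O ∷ O ∷ I ∷ I ∷ I ∷ I ∷ O ∷ O ∷ O ∷ I ∷ I ∷ []) ∷
  (I ∷ O ∷ I ∷ I ∷ I ∷ I ∷ I ∷ O ∷ O ∷ O ∷ I ∷ O ∷ O ∷ I ∷ I ∷ []) ∷
  (O ∷ I ∷ I ∷ I ∷ I ∷ O ∷ I ∷ I ∷ O ∷ O ∷ I ∷ O ∷ O ∷ I ∷ I ∷ []) ∷
  (O ∷ O ∷ I ∷ I ∷ I ∷ I ∷ I ∷ I ∷ O ∷ O ∷ I ∷ O ∷ O ∷ I ∷ I ∷ []) ∷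
  (I ∷ I ∷ I ∷ I ∷ O ∷ O ∷ O ∷ I ∷ I ∷ O ∷ I ∷ O ∷ O ∷ I ∷ I ∷ []) ∷
  (O ∷ I ∷ I ∷ I ∷ O ∷ O ∷ I ∷ I ∷ I ∷ O ∷ I ∷ O ∷ O ∷ I ∷ I ∷ []) ∷
  (O ∷ O ∷ I ∷ I ∷ O ∷ I ∷ I ∷ I ∷ I ∷ O ∷ I ∷ O ∷ O ∷ I ∷ I ∷ []) ∷
  (I ∷ I ∷ O ∷ I ∷ I ∷ I ∷ O ∷ O ∷ O ∷ I ∷ I ∷ O ∷ O ∷ I ∷ I ∷ []) ∷
  (I ∷ O ∷ O ∷ I ∷ I ∷ I ∷ I ∷ O ∷ O ∷ I ∷ I ∷ O ∷ O ∷ I ∷ I ∷ []) ∷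
  (O ∷ O ∷ O ∷ I ∷ I ∷ I ∷ I ∷ I ∷ O ∷ I ∷ I ∷ O ∷ O ∷ I ∷ I ∷ []) ∷
  (I ∷ I ∷ I ∷ O ∷ I ∷ O ∷ O ∷ O ∷ I ∷ I ∷ I ∷ O ∷ O ∷ I ∷ I ∷ []) ∷
  (I ∷ I ∷ O ∷ O ∷ I ∷ I ∷ O ∷ O ∷ I ∷ I ∷ I ∷ O ∷ O ∷ I ∷ I ∷ []) ∷
  (I ∷ O ∷ O ∷ O ∷ I ∷ I ∷ I ∷ O ∷ I ∷ I ∷ I ∷ O ∷ O ∷ I ∷ I ∷ []) ∷
  (I ∷ I ∷ I ∷ O ∷ O ∷ O ∷ O ∷ I ∷ I ∷ I ∷ I ∷ O ∷ O ∷ I ∷ I ∷ []) ∷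
  (I ∷ I ∷ O ∷ O ∷ O ∷ I ∷ O ∷ I ∷ I ∷ I ∷ I ∷ O ∷ O ∷ I ∷ I ∷ []) ∷
  (O ∷ I ∷ I ∷ O ∷ O ∷ O ∷ I ∷ I ∷ I ∷ I ∷ I ∷ O ∷ O ∷ I ∷ I ∷ []) ∷
  (O ∷ I ∷ I ∷ I ∷ I ∷ I ∷ O ∷ I ∷ O ∷ O ∷ O ∷ I ∷ O ∷ I ∷ I ∷ []) ∷
  (I ∷ I ∷ O ∷ I ∷ I ∷ I ∷ O ∷ O ∷ I ∷ O ∷ O ∷ I ∷ O ∷ I ∷ I ∷ []) ∷
  (I ∷ I ∷ I ∷ I ∷ O ∷ O ∷ I ∷ O ∷ I ∷ O ∷ O ∷ I ∷ O ∷ I ∷ I ∷ []) ∷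
  (I ∷ I ∷ O ∷ I ∷ O ∷ I ∷ I ∷ O ∷ I ∷ O ∷ O ∷ I ∷ O ∷ I ∷ I ∷ []) ∷
  (O ∷ I ∷ O ∷ I ∷ I ∷ I ∷ O ∷ I ∷ I ∷ O ∷ O ∷ I ∷ O ∷ I ∷ I ∷ []) ∷
  (O ∷ I ∷ O ∷ I ∷ O ∷ I ∷ I ∷ I ∷ I ∷ O ∷ O ∷ I ∷ O ∷ I ∷ I ∷ []) ∷
  (I ∷ O ∷ I ∷ I ∷ I ∷ O ∷ I ∷ O ∷ O ∷ I ∷ O ∷ I ∷ O ∷ I ∷ I ∷ []) ∷
  (I ∷ I ∷ I ∷ O ∷ I ∷ O ∷ O ∷ I ∷ O ∷ I ∷ O ∷ I ∷ O ∷ I ∷ I ∷ []) ∷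
  (O ∷ I ∷ I ∷ O ∷ I ∷ I ∷ O ∷ I ∷ O ∷ I ∷ O ∷ I ∷ O ∷ I ∷ I ∷ []) ∷
  (I ∷ O ∷ I ∷ O ∷ I ∷ O ∷ I ∷ I ∷ O ∷ I ∷ O ∷ I ∷ O ∷ I ∷ I ∷ []) ∷
  (O ∷ O ∷ I ∷ O ∷ I ∷ I ∷ I ∷ I ∷ O ∷ I ∷ O ∷ I ∷ O ∷ I ∷ I ∷ []) ∷
  (I ∷ O ∷ I ∷ I ∷ O ∷ O ∷ I ∷ O ∷ I ∷ I ∷ O ∷ I ∷ O ∷ I ∷ I ∷ []) ∷
  (I ∷ O ∷ O ∷ I ∷ O ∷ I ∷ I ∷ O ∷ I ∷ I ∷ O ∷ I ∷ O ∷ I ∷ I ∷ []) ∷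
  (O ∷ I ∷ O ∷ O ∷ I ∷ I ∷ O ∷ I ∷ I ∷ I ∷ O ∷ I ∷ O ∷ I ∷ I ∷ []) ∷
  (I ∷ O ∷ I ∷ O ∷ O ∷ O ∷ I ∷ I ∷ I ∷ I ∷ O ∷ I ∷ O ∷ I ∷ I ∷ []) ∷
  (I ∷ I ∷ O ∷ I ∷ I ∷ I ∷ O ∷ O ∷ O ∷ O ∷ I ∷ I ∷ O ∷ I ∷ I ∷ []) ∷
  (I ∷ O ∷ I ∷ I ∷ I ∷ O ∷ I ∷ O ∷ O ∷ O ∷ I ∷ I ∷ O ∷ I ∷ I ∷ []) ∷
  (I ∷ O ∷ O ∷ I ∷ I ∷ I ∷ I ∷ O ∷ O ∷ O ∷ I ∷ I ∷ O ∷ I ∷ I ∷ []) ∷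
  (O ∷ I ∷ I ∷ I ∷ I ∷ O ∷ O ∷ I ∷ O ∷ O ∷ I ∷ I ∷ O ∷ I ∷ I ∷ []) ∷
  (O ∷ I ∷ O ∷ I ∷ I ∷ I ∷ O ∷ I ∷ O ∷ O ∷ I ∷ I ∷ O ∷ I ∷ I ∷ []) ∷
  (O ∷ O ∷ I ∷ I ∷ I ∷ O ∷ I ∷ I ∷ O ∷ O ∷ I ∷ I ∷ O ∷ I ∷ I ∷ []) ∷
  (O ∷ O ∷ O ∷ I ∷ I ∷ I ∷ I ∷ I ∷ O ∷ O ∷ I ∷ I ∷ O ∷ I ∷ I ∷ []) ∷
  (I ∷ I ∷ I ∷ I ∷ O ∷ O ∷ O ∷ O ∷ I ∷ O ∷ I ∷ I ∷ O ∷ I ∷ I ∷ []) ∷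
  (I ∷ I ∷ O ∷ I ∷ O ∷ I ∷ O ∷ O ∷ I ∷ O ∷ I ∷ I ∷ O ∷ I ∷ I ∷ []) ∷
  (I ∷ O ∷ I ∷ I ∷ O ∷ O ∷ I ∷ O ∷ I ∷ O ∷ I ∷ I ∷ O ∷ I ∷ I ∷ []) ∷
  (I ∷ O ∷ O ∷ I ∷ O ∷ I ∷ I ∷ O ∷ I ∷ O ∷ I ∷ I ∷ O ∷ I ∷ I ∷ []) ∷
  (O ∷ I ∷ I ∷ I ∷ O ∷ O ∷ O ∷ I ∷ I ∷ O ∷ I ∷ I ∷ O ∷ I ∷ I ∷ []) ∷
  (O ∷ I ∷ O ∷ I ∷ O ∷ I ∷ O ∷ I ∷ I ∷ O ∷ I ∷ I ∷ O ∷ I ∷ I ∷ []) ∷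
  (O ∷ O ∷ I ∷ I ∷ O ∷ O ∷ I ∷ I ∷ I ∷ O ∷ I ∷ I ∷ O ∷ I ∷ I ∷ []) ∷
  (O ∷ O ∷ O ∷ I ∷ O ∷ I ∷ I ∷ I ∷ I ∷ O ∷ I ∷ I ∷ O ∷ I ∷ I ∷ []) ∷
  (I ∷ I ∷ I ∷ O ∷ I ∷ O ∷ O ∷ O ∷ O ∷ I ∷ I ∷ I ∷ O ∷ I ∷ I ∷ []) ∷
  (I ∷ I ∷ O ∷ O ∷ I ∷ I ∷ O ∷ O ∷ O ∷ I ∷ I ∷ I ∷ O ∷ I ∷ I ∷ []) ∷
  (I ∷ O ∷ I ∷ O ∷ I ∷ O ∷ I ∷ O ∷ O ∷ I ∷ I ∷ I ∷ O ∷ I ∷ I ∷ []) ∷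
  (I ∷ O ∷ O ∷ O ∷ I ∷ I ∷ I ∷ O ∷ O ∷ I ∷ I ∷ I ∷ O ∷ I ∷ I ∷ []) ∷
  (O ∷ I ∷ I ∷ O ∷ I ∷ O ∷ O ∷ I ∷ O ∷ I ∷ I ∷ I ∷ O ∷ I ∷ I ∷ []) ∷
  (O ∷ I ∷ O ∷ O ∷ I ∷ I ∷ O ∷ I ∷ O ∷ I ∷ I ∷ I ∷ O ∷ I ∷ I ∷ []) ∷
  (O ∷ O ∷ I ∷ O ∷ I ∷ O ∷ I ∷ I ∷ O ∷ I ∷ I ∷ I ∷ O ∷ I ∷ I ∷ []) ∷
  (O ∷ O ∷ O ∷ O ∷ I ∷ I ∷ I ∷ I ∷ O ∷ I ∷ I ∷ I ∷ O ∷ I ∷ I ∷ []) ∷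
  (I ∷ I ∷ I ∷ O ∷ O ∷ O ∷ O ∷ O ∷ I ∷ I ∷ I ∷ I ∷ O ∷ I ∷ I ∷ []) ∷
  (I ∷ I ∷ O ∷ O ∷ O ∷ I ∷ O ∷ O ∷ I ∷ I ∷ I ∷ I ∷ O ∷ I ∷ I ∷ []) ∷
  (I ∷ O ∷ I ∷ O ∷ O ∷ O ∷ I ∷ O ∷ I ∷ I ∷ I ∷ I ∷ O ∷ I ∷ I ∷ []) ∷
  (I ∷ O ∷ O ∷ O ∷ O ∷ I ∷ I ∷ O ∷ I ∷ I ∷ I ∷ I ∷ O ∷ I ∷ I ∷ []) ∷
  (O ∷ I ∷ I ∷ O ∷ O ∷ O ∷ O ∷ I ∷ I ∷ I ∷ I ∷ I ∷ O ∷ I ∷ I ∷ []) ∷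
  (O ∷ I ∷ O ∷ O ∷ O ∷ I ∷ O ∷ I ∷ I ∷ I ∷ I ∷ I ∷ O ∷ I ∷ I ∷ []) ∷
  (O ∷ O ∷ I ∷ O ∷ O ∷ O ∷ I ∷ I ∷ I ∷ I ∷ I ∷ I ∷ O ∷ I ∷ I ∷ []) ∷
  (O ∷ I ∷ I ∷ I ∷ I ∷ I ∷ I ∷ O ∷ O ∷ O ∷ O ∷ O ∷ I ∷ I ∷ I ∷ []) ∷
  (I ∷ I ∷ I ∷ I ∷ O ∷ O ∷ I ∷ I ∷ O ∷ O ∷ O ∷ O ∷ I ∷ I ∷ I ∷ []) ∷
  (O ∷ I ∷ I ∷ I ∷ O ∷ I ∷ I ∷ I ∷ O ∷ O ∷ O ∷ O ∷ I ∷ I ∷ I ∷ []) ∷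
  (I ∷ I ∷ I ∷ O ∷ I ∷ O ∷ O ∷ I ∷ I ∷ O ∷ O ∷ O ∷ I ∷ I ∷ I ∷ []) ∷
  (I ∷ I ∷ I ∷ O ∷ O ∷ O ∷ I ∷ I ∷ I ∷ O ∷ O ∷ O ∷ I ∷ I ∷ I ∷ []) ∷
  (O ∷ I ∷ I ∷ O ∷ O ∷ I ∷ I ∷ I ∷ I ∷ O ∷ O ∷ O ∷ I ∷ I ∷ I ∷ []) ∷
  (I ∷ O ∷ I ∷ I ∷ I ∷ I ∷ O ∷ O ∷ O ∷ I ∷ O ∷ O ∷ I ∷ I ∷ I ∷ []) ∷
  (O ∷ O ∷ I ∷ I ∷ I ∷ I ∷ I ∷ O ∷ O ∷ I ∷ O ∷ O ∷ I ∷ I ∷ I ∷ []) ∷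
  (O ∷ O ∷ I ∷ I ∷ O ∷ I ∷ I ∷ I ∷ O ∷ I ∷ O ∷ O ∷ I ∷ I ∷ I ∷ []) ∷
  (I ∷ I ∷ O ∷ I ∷ I ∷ O ∷ O ∷ O ∷ I ∷ I ∷ O ∷ O ∷ I ∷ I ∷ I ∷ []) ∷
  (I ∷ O ∷ O ∷ I ∷ I ∷ I ∷ O ∷ O ∷ I ∷ I ∷ O ∷ O ∷ I ∷ I ∷ I ∷ []) ∷
  (O ∷ O ∷ O ∷ I ∷ I ∷ I ∷ I ∷ O ∷ I ∷ I ∷ O ∷ O ∷ I ∷ I ∷ I ∷ []) ∷
  (I ∷ I ∷ O ∷ O ∷ I ∷ O ∷ O ∷ I ∷ I ∷ I ∷ O ∷ O ∷ I ∷ I ∷ I ∷ []) ∷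
  (I ∷ O ∷ O ∷ O ∷ I ∷ I ∷ O ∷ I ∷ I ∷ I ∷ O ∷ O ∷ I ∷ I ∷ I ∷ []) ∷
  (I ∷ I ∷ O ∷ O ∷ O ∷ O ∷ I ∷ I ∷ I ∷ I ∷ O ∷ O ∷ I ∷ I ∷ I ∷ []) ∷
  (I ∷ O ∷ I ∷ I ∷ I ∷ I ∷ O ∷ O ∷ O ∷ O ∷ I ∷ O ∷ I ∷ I ∷ I ∷ []) ∷
  (O ∷ I ∷ I ∷ I ∷ I ∷ O ∷ I ∷ O ∷ O ∷ O ∷ I ∷ O ∷ I ∷ I ∷ I ∷ []) ∷
  (O ∷ O ∷ I ∷ I ∷ I ∷ I ∷ I ∷ O ∷ O ∷ O ∷ I ∷ O ∷ I ∷ I ∷ I ∷ []) ∷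
  (I ∷ I ∷ I ∷ I ∷ O ∷ O ∷ O ∷ I ∷ O ∷ O ∷ I ∷ O ∷ I ∷ I ∷ I ∷ []) ∷
  (I ∷ O ∷ I ∷ I ∷ O ∷ I ∷ O ∷ I ∷ O ∷ O ∷ I ∷ O ∷ I ∷ I ∷ I ∷ []) ∷
  (O ∷ I ∷ I ∷ I ∷ O ∷ O ∷ I ∷ I ∷ O ∷ O ∷ I ∷ O ∷ I ∷ I ∷ I ∷ []) ∷
  (O ∷ O ∷ I ∷ I ∷ O ∷ I ∷ I ∷ I ∷ O ∷ O ∷ I ∷ O ∷ I ∷ I ∷ I ∷ []) ∷
  (I ∷ I ∷ I ∷ O ∷ I ∷ O ∷ O ∷ O ∷ I ∷ O ∷ I ∷ O ∷ I ∷ I ∷ I ∷ []) ∷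
  (I ∷ O ∷ I ∷ O ∷ I ∷ I ∷ O ∷ O ∷ I ∷ O ∷ I ∷ O ∷ I ∷ I ∷ I ∷ []) ∷
  (O ∷ I ∷ I ∷ O ∷ I ∷ O ∷ I ∷ O ∷ I ∷ O ∷ I ∷ O ∷ I ∷ I ∷ I ∷ []) ∷
  (O ∷ O ∷ I ∷ O ∷ I ∷ I ∷ I ∷ O ∷ I ∷ O ∷ I ∷ O ∷ I ∷ I ∷ I ∷ []) ∷
  (I ∷ I ∷ I ∷ O ∷ O ∷ O ∷ O ∷ I ∷ I ∷ O ∷ I ∷ O ∷ I ∷ I ∷ I ∷ []) ∷
  (I ∷ O ∷ I ∷ O ∷ O ∷ I ∷ O ∷ I ∷ I ∷ O ∷ I ∷ O ∷ I ∷ I ∷ I ∷ []) ∷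
  (O ∷ I ∷ I ∷ O ∷ O ∷ O ∷ I ∷ I ∷ I ∷ O ∷ I ∷ O ∷ I ∷ I ∷ I ∷ []) ∷
  (O ∷ O ∷ I ∷ O ∷ O ∷ I ∷ I ∷ I ∷ I ∷ O ∷ I ∷ O ∷ I ∷ I ∷ I ∷ []) ∷
  (I ∷ I ∷ O ∷ I ∷ I ∷ O ∷ O ∷ O ∷ O ∷ I ∷ I ∷ O ∷ I ∷ I ∷ I ∷ []) ∷
  (I ∷ O ∷ O ∷ I ∷ I ∷ I ∷ O ∷ O ∷ O ∷ I ∷ I ∷ O ∷ I ∷ I ∷ I ∷ []) ∷
  (O ∷ I ∷ O ∷ I ∷ I ∷ O ∷ I ∷ O ∷ O ∷ I ∷ I ∷ O ∷ I ∷ I ∷ I ∷ []) ∷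
  (O ∷ O ∷ O ∷ I ∷ I ∷ I ∷ I ∷ O ∷ O ∷ I ∷ I ∷ O ∷ I ∷ I ∷ I ∷ []) ∷
  (I ∷ I ∷ O ∷ I ∷ O ∷ O ∷ O ∷ I ∷ O ∷ I ∷ I ∷ O ∷ I ∷ I ∷ I ∷ []) ∷
  (I ∷ O ∷ O ∷ I ∷ O ∷ I ∷ O ∷ I ∷ O ∷ I ∷ I ∷ O ∷ I ∷ I ∷ I ∷ []) ∷
  (O ∷ I ∷ O ∷ I ∷ O ∷ O ∷ I ∷ I ∷ O ∷ I ∷ I ∷ O ∷ I ∷ I ∷ I ∷ []) ∷
  (O ∷ O ∷ O ∷ I ∷ O ∷ I ∷ I ∷ I ∷ O ∷ I ∷ I ∷ O ∷ I ∷ I ∷ I ∷ []) ∷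
  (I ∷ I ∷ O ∷ O ∷ I ∷ O ∷ O ∷ O ∷ I ∷ I ∷ I ∷ O ∷ I ∷ I ∷ I ∷ []) ∷
  (I ∷ O ∷ O ∷ O ∷ I ∷ I ∷ O ∷ O ∷ I ∷ I ∷ I ∷ O ∷ I ∷ I ∷ I ∷ []) ∷
  (O ∷ I ∷ O ∷ O ∷ I ∷ O ∷ I ∷ O ∷ I ∷ I ∷ I ∷ O ∷ I ∷ I ∷ I ∷ []) ∷
  (O ∷ O ∷ O ∷ O ∷ I ∷ I ∷ I ∷ O ∷ I ∷ I ∷ I ∷ O ∷ I ∷ I ∷ I ∷ []) ∷
  (I ∷ I ∷ O ∷ O ∷ O ∷ O ∷ O ∷ I ∷ I ∷ I ∷ I ∷ O ∷ I ∷ I ∷ I ∷ []) ∷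
  (I ∷ O ∷ O ∷ O ∷ O ∷ I ∷ O ∷ I ∷ I ∷ I ∷ I ∷ O ∷ I ∷ I ∷ I ∷ []) ∷
  (O ∷ I ∷ O ∷ O ∷ O ∷ O ∷ I ∷ I ∷ I ∷ I ∷ I ∷ O ∷ I ∷ I ∷ I ∷ []) ∷
  (O ∷ I ∷ I ∷ I ∷ I ∷ I ∷ O ∷ O ∷ O ∷ O ∷ O ∷ I ∷ I ∷ I ∷ I ∷ []) ∷
  (I ∷ I ∷ I ∷ I ∷ O ∷ O ∷ I ∷ O ∷ O ∷ O ∷ O ∷ I ∷ I ∷ I ∷ I ∷ []) ∷
  (O ∷ I ∷ I ∷ I ∷ O ∷ I ∷ I ∷ O ∷ O ∷ O ∷ O ∷ I ∷ I ∷ I ∷ I ∷ []) ∷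
  (I ∷ I ∷ I ∷ O ∷ I ∷ O ∷ O ∷ I ∷ O ∷ O ∷ O ∷ I ∷ I ∷ I ∷ I ∷ []) ∷
  (O ∷ I ∷ I ∷ O ∷ I ∷ I ∷ O ∷ I ∷ O ∷ O ∷ O ∷ I ∷ I ∷ I ∷ I ∷ []) ∷
  (I ∷ I ∷ I ∷ O ∷ O ∷ O ∷ I ∷ I ∷ O ∷ O ∷ O ∷ I ∷ I ∷ I ∷ I ∷ []) ∷
  (O ∷ I ∷ I ∷ O ∷ O ∷ I ∷ I ∷ I ∷ O ∷ O ∷ O ∷ I ∷ I ∷ I ∷ I ∷ []) ∷
  (I ∷ I ∷ O ∷ I ∷ I ∷ O ∷ O ∷ O ∷ I ∷ O ∷ O ∷ I ∷ I ∷ I ∷ I ∷ []) ∷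
  (O ∷ I ∷ O ∷ I ∷ I ∷ I ∷ O ∷ O ∷ I ∷ O ∷ O ∷ I ∷ I ∷ I ∷ I ∷ []) ∷
  (I ∷ I ∷ O ∷ I ∷ O ∷ O ∷ I ∷ O ∷ I ∷ O ∷ O ∷ I ∷ I ∷ I ∷ I ∷ []) ∷
  (O ∷ I ∷ O ∷ I ∷ O ∷ I ∷ I ∷ O ∷ I ∷ O ∷ O ∷ I ∷ I ∷ I ∷ I ∷ []) ∷
  (I ∷ I ∷ O ∷ O ∷ I ∷ O ∷ O ∷ I ∷ I ∷ O ∷ O ∷ I ∷ I ∷ I ∷ I ∷ []) ∷
  (O ∷ I ∷ O ∷ O ∷ I ∷ I ∷ O ∷ I ∷ I ∷ O ∷ O ∷ I ∷ I ∷ I ∷ I ∷ []) ∷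
  (I ∷ I ∷ O ∷ O ∷ O ∷ O ∷ I ∷ I ∷ I ∷ O ∷ O ∷ I ∷ I ∷ I ∷ I ∷ []) ∷
  (O ∷ I ∷ O ∷ O ∷ O ∷ I ∷ I ∷ I ∷ I ∷ O ∷ O ∷ I ∷ I ∷ I ∷ I ∷ []) ∷
  (I ∷ O ∷ I ∷ I ∷ I ∷ O ∷ O ∷ O ∷ O ∷ I ∷ O ∷ I ∷ I ∷ I ∷ I ∷ []) ∷
  (O ∷ O ∷ I ∷ I ∷ I ∷ I ∷ O ∷ O ∷ O ∷ I ∷ O ∷ I ∷ I ∷ I ∷ I ∷ []) ∷
  (I ∷ O ∷ I ∷ I ∷ O ∷ O ∷ I ∷ O ∷ O ∷ I ∷ O ∷ I ∷ I ∷ I ∷ I ∷ []) ∷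
  (O ∷ O ∷ I ∷ I ∷ O ∷ I ∷ I ∷ O ∷ O ∷ I ∷ O ∷ I ∷ I ∷ I ∷ I ∷ []) ∷
  (I ∷ O ∷ I ∷ O ∷ I ∷ O ∷ O ∷ I ∷ O ∷ I ∷ O ∷ I ∷ I ∷ I ∷ I ∷ []) ∷
  (O ∷ O ∷ I ∷ O ∷ I ∷ I ∷ O ∷ I ∷ O ∷ I ∷ O ∷ I ∷ I ∷ I ∷ I ∷ []) ∷
  (I ∷ O ∷ I ∷ O ∷ O ∷ O ∷ I ∷ I ∷ O ∷ I ∷ O ∷ I ∷ I ∷ I ∷ I ∷ []) ∷
  (O ∷ O ∷ I ∷ O ∷ O ∷ I ∷ I ∷ I ∷ O ∷ I ∷ O ∷ I ∷ I ∷ I ∷ I ∷ []) ∷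
  (I ∷ O ∷ O ∷ I ∷ I ∷ O ∷ O ∷ O ∷ I ∷ I ∷ O ∷ I ∷ I ∷ I ∷ I ∷ []) ∷
  (O ∷ O ∷ O ∷ I ∷ I ∷ I ∷ O ∷ O ∷ I ∷ I ∷ O ∷ I ∷ I ∷ I ∷ I ∷ []) ∷
  (I ∷ O ∷ O ∷ I ∷ O ∷ O ∷ I ∷ O ∷ I ∷ I ∷ O ∷ I ∷ I ∷ I ∷ I ∷ []) ∷
  (O ∷ O ∷ O ∷ I ∷ O ∷ I ∷ I ∷ O ∷ I ∷ I ∷ O ∷ I ∷ I ∷ I ∷ I ∷ []) ∷
  (I ∷ O ∷ O ∷ O ∷ I ∷ O ∷ O ∷ I ∷ I ∷ I ∷ O ∷ I ∷ I ∷ I ∷ I ∷ []) ∷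
  (O ∷ O ∷ O ∷ O ∷ I ∷ I ∷ O ∷ I ∷ I ∷ I ∷ O ∷ I ∷ I ∷ I ∷ I ∷ []) ∷
  (I ∷ O ∷ O ∷ O ∷ O ∷ O ∷ I ∷ I ∷ I ∷ I ∷ O ∷ I ∷ I ∷ I ∷ I ∷ []) ∷
  (O ∷ O ∷ O ∷ O ∷ O ∷ O ∷ O ∷ O ∷ O ∷ O ∷ I ∷ I ∷ I ∷ I ∷ I ∷ []) ∷
  []

witness₁₅ : Witness 15 428
witness₁₅ = Certificate.certify latin-edges (quotient 5) latin-minimal _ _ _ _ _ _

some-witness : ∀ r → Witness (r + 3) 1
some-witness 0                   = witness₃
some-witness 1                   = witness₄
some-witness 2                   = witness₅
some-witness (suc (suc (suc r))) = witness₃ ⊗ some-witness r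

copies : ∀ {k d} → Witness k d → ∀ q → Witness (q * k) (d ^ q)
copies W zero    = witness₀
copies W (suc q) = W ⊗ copies W q

-- c ≥ (a / b)ⁿ / B, stated without division as aⁿ ≤ B · bⁿ · c.
record LowerBound (a b B n c : ℕ) : Set where
  constructor lowerBound
  field bound : a ^ n ≤ B * b ^ n * c

lowerBound-* : ∀ {a b B₁ B₂ m k c₁ c₂} → LowerBound a b B₁ m c₁ → LowerBound a b B₂ k c₂ →
               LowerBound a b (B₁ * B₂) (m + k) (c₁ * c₂)
lowerBound-* {a} {b} {B₁} {B₂} {m} {k} {c₁} {c₂} (lowerBound bound₁) (lowerBound bound₂) =
  lowerBound (begin
  a ^ (m + k)                              ≡⟨ ^-distribˡ-+-* a m k ⟩
  a ^ m * a ^ k                            ≤⟨ *-mono-≤ bound₁ bound₂ ⟩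
  (B₁ * b ^ m * c₁) * (B₂ * b ^ k * c₂)    ≡⟨ regroup B₁ B₂ (b ^ m) (b ^ k) c₁ c₂ ⟩
  B₁ * B₂ * (b ^ m * b ^ k) * (c₁ * c₂)
    ≡⟨ cong (λ x → B₁ * B₂ * x * (c₁ * c₂)) (^-distribˡ-+-* b m k) ⟨
  B₁ * B₂ * b ^ (m + k) * (c₁ * c₂)        ∎)
  where
  open ≤-Reasoning
  open +-*-Solver
  regroup : ∀ B₁ B₂ x y c₁ c₂ → (B₁ * x * c₁) * (B₂ * y * c₂) ≡ B₁ * B₂ * (x * y) * (c₁ * c₂)
  regroup = solve 6 (λ B₁ B₂ x y c₁ c₂ →
    (B₁ :* x :* c₁) :* (B₂ :* y :* c₂) := B₁ :* B₂ :* (x :* y) :* (c₁ :* c₂)) refl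

lowerBound-small : ∀ a b .{{_ : NonZero a}} .{{_ : NonZero b}} {s t c} → s ≤ t → 1 ≤ c →
                   LowerBound a b (a ^ t) s c
lowerBound-small a b {s} {t} {c} s≤t 1≤c = lowerBound (begin
  a ^ s              ≤⟨ ^-monoʳ-≤ a s≤t ⟩
  a ^ t              ≡⟨ trans (*-identityʳ (a ^ t * 1)) (*-identityʳ (a ^ t)) ⟨
  a ^ t * 1 * 1      ≤⟨ *-mono-≤ (*-monoʳ-≤ (a ^ t) (m^n>0 b s)) 1≤c ⟩
  a ^ t * b ^ s * c  ∎)
  where open ≤-Reasoning

copies-bound : ∀ {a b k d} → LowerBound a b 1 k d → ∀ q → LowerBound a b 1 (q * k) (d ^ q)
copies-bound bound zero    = lowerBound ≤-refl
copies-bound bound (suc q) = lowerBound-* bound (copies-bound bound q)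

latin-bound : LowerBound 14977 10000 1 15 428
latin-bound = lowerBound (≤ᵇ⇒≤ _ _ tt)

B : ℕ
B = 14977 ^ 17

Claim : ℕ → Set₁
Claim n = Σ (Tri3Hypergraph n) λ H → Σ (List (Subset n)) λ L →
  Unique L × All (MinimalTransversal (Tri3Hypergraph.edge H)) L ×
  1 * 14977 ^ n ≤ B * 10000 ^ n * length L

witness⇒claim : ∀ {n c} → Witness n c → LowerBound 14977 10000 B n c → Claim n
witness⇒claim {n} {c} W (lowerBound bound) = hypergraph , transversals , distinct , minimal , (begin
  1 * 14977 ^ n                        ≡⟨ *-identityˡ (14977 ^ n) ⟩
  14977 ^ n                            ≤⟨ bound ⟩
  B * 10000 ^ n * c                    ≤⟨ *-monoʳ-≤ (B * 10000 ^ n) enough ⟩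
  B * 10000 ^ n * length transversals  ∎)
  where
  open Witness W
  open ≤-Reasoning

claim : ∀ q r → r < 15 → Claim (q * 15 + (r + 3))
claim q r r<15 = witness⇒claim (copies witness₁₅ q ⊗ some-witness r)
  (lowerBound-* (copies-bound latin-bound q) (lowerBound-small 14977 10000 r+3≤17 ≤-refl))
  where
  r+3≤17 : r + 3 ≤ 17
  r+3≤17 = +-monoˡ-≤ 3 (s≤s⁻¹ r<15)

division : ∀ n → 3 ≤ n → (n ∸ 3) / 15 * 15 + ((n ∸ 3) % 15 + 3) ≡ n
division n 3≤n = begin
  q * 15 + (r + 3)  ≡⟨ rearrange q r ⟩
  3 + (r + q * 15)  ≡⟨ cong (3 +_) (m≡m%n+[m/n]*n (n ∸ 3) 15) ⟨
  3 + (n ∸ 3)       ≡⟨ m+[n∸m]≡n 3≤n ⟩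
  n                 ∎
  where
  open ≡-Reasoning
  open +-*-Solver
  q r : ℕ
  q = (n ∸ 3) / 15
  r = (n ∸ 3) % 15
  rearrange : ∀ q r → q * 15 + (r + 3) ≡ 3 + (r + q * 15)
  rearrange = solve 2 (λ q r → q :* con 15 :+ (r :+ con 3) := con 3 :+ (r :+ q :* con 15)) refl

theorem1 : Σ ℕ λ a → Σ ℕ λ b → 0 < a × 0 < b ×
    ((n : ℕ) → 3 ≤ n →
    Σ (Tri3Hypergraph n) λ H → Σ (List (Subset n)) λ L →
    Unique L × All (MinimalTransversal (Tri3Hypergraph.edge H)) L ×
    a * 14977 ^ n ≤ b * 10000 ^ n * length L)
theorem1 = 1 , B , s≤s z≤n , m^n>0 14977 17 , λ n 3≤n →
  subst Claim (division n 3≤n) (claim ((n ∸ 3) / 15) ((n ∸ 3) % 15) (m%n<n (n ∸ 3) 15))
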